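{- Let $G=(V,E)$ be a finite undirected Dirac graph, i.e. every node has degree at least $n/2$ where $n=|V|$, and let $t(u)=2$ for every $u\in V$. Then every execution of the algorithm MTS on input $(G,t)$ returns a minimum-size target set for $G$ with thresholds $t$.
   Context: Graphs are finite, without loops. An undirected graph is treated as the bidirected digraph in which each edge $\{u,v\}$ is replaced by the two arcs $(u,v),(v,u)$. For a digraph $G=(V,E)$ and $v\in V$, $\Gamma^{in}(v)=\{u:(u,v)\in E\}$ and $\Gamma^{out}(v)=\{u:(v,u)\in E\}$. Given thresholds $t:V\to\mathbb{N}=\{0,1,2,\dots\}$ and $S\subseteq V$, the activation process starting at $S$ is $A_0=S$ and $A_\ell=A_{\ell-1}\cup\{u\in V: |\Gamma^{in}(u)\cap A_{\ell-1}|\ge t(u)\}$ for $\ell\ge1$. $S$ is a target set for $(G,t)$ if $A_\lambda=V$ for some $\lambda\ge0$. Algorithm MTS on input $(G,t)$: set $S=\emptyset$, $L=\emptyset$, $U=V$, and for each $v\in V$ set $k(v)=t(v)$, $\delta(v)=|\Gamma^{in}(v)|$. While $U\neq\emptyset$, perform one iteration as follows. Case 1: if some $v\in U$ has $k(v)=0$, select such a $v$; for each $u\in\Gamma^{out}(v)\cap U$ set $k(u)=\max(k(u)-1,0)$ and, if $v\notin L$, set $\delta(u)=\delta(u)-1$; then set $U=U\setminus\{v\}$. Case 2: otherwise, if some $v\in U\setminus L$ has $\delta(v)<k(v)$, select such a $v$; set $S=S\cup\{v\}$; for each $u\in\Gamma^{out}(v)\cap U$ set $k(u)=k(u)-1$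 and $\delta(u)=\delta(u)-1$; then set $U=U\setminus\{v\}$. Case 3: otherwise, select $v\in U\setminus L$ maximizing $\frac{k(u)}{\delta(u)(\delta(u)+1)}$ over $u\in U\setminus L$; for each $u\in\Gamma^{out}(v)\cap U$ set $\delta(u)=\delta(u)-1$; set $L=L\cup\{v\}$. When $U=\emptyset$, return $S$. Whenever several nodes qualify in a case, one of them is chosen arbitrarily. -}

module Defs where

open import Data.Nat using (ℕ; zero; suc; _+_; _*_; _∸_; _≤_; _<_; _≤?_)
open import Data.Bool using (Bool; true; false; _∧_; not; if_then_else_)
open import Data.Fin using (Fin)
open import Data.Fin.Subset using (Subset; ⊥; ⊤; ⁅_⁆; _∪_; _∩_; _-_; ∣_∣; _∈_; _∉_)
open import Data.Vec using (Vec; lookup; tabulate)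
open import Data.Product using (∃; _×_)
open import Relation.Nullary using (¬_)
open import Relation.Nullary.Decidable using (⌊_⌋)
open import Relation.Binary.PropositionalEquality using (_≡_)

-- It is treated as the bidirected digraph: (u,v) is an arc iff adj u v ≡ true.
record Graph (n : ℕ) : Set where
  field
    adj      : Fin n → Fin n → Bool
    adj-sym  : ∀ u v → adj u v ≡ adj v u
    loopless : ∀ v → adj v v ≡ false
open Graph public

module _ {n : ℕ} (G : Graph n) where

  Γin : Fin n → Subset n
  Γin v = tabulate (λ u → adj G u v)

  Γout : Fin n → Subset n
  Γout v = tabulate (λ u → adj G v u)

  deg : Fin n → ℕ
  deg v = ∣ Γin v ∣

  Dirac : Set
  Dirac = ∀ v → n ≤ 2 * deg v

  Active : (Fin n → ℕ) → Subset n → ℕ → Subset n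
  Active t S zero = S
  Active t S (suc ℓ) =
    Active t S ℓ ∪ tabulate (λ u → ⌊ t u ≤? ∣ Γin u ∩ Active t S ℓ ∣ ⌋)

  IsTargetSet : (Fin n → ℕ) → Subset n → Set
  IsTargetSet t S = ∃ λ λ' → ∀ v → v ∈ Active t S λ'

record State (n : ℕ) : Set where
  constructor state
  field
    S L U : Subset n
    k δ   : Fin n → ℕ
open State public

module _ {n : ℕ} (G : Graph n) where

  nbU : State n → Fin n → Fin n → Bool
  nbU s v u = adj G v u ∧ lookup (U s) u

  initState : (Fin n → ℕ) → State n
  initState t = state ⊥ ⊥ ⊤ t (λ v → ∣ Γin G v ∣)

  -- one iteration of the while loop (nondeterministic choice of v)
  data Step (s : State n) : State n → Set where
    case1 : (v : Fin n) → v ∈ U s → k s v ≡ 0 →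
      Step s (state (S s) (L s) (U s - v)
                (λ u → if nbU s v u then k s u ∸ 1 else k s u)
                (λ u → if nbU s v u ∧ not (lookup (L s) v) then δ s u ∸ 1 else δ s u))
    case2 : (∀ u → u ∈ U s → ¬ (k s u ≡ 0)) →
      (v : Fin n) → v ∈ U s → v ∉ L s → δ s v < k s v →
      Step s (state (S s ∪ ⁅ v ⁆) (L s) (U s - v)
                (λ u → if nbU s v u then k s u ∸ 1 else k s u)
                (λ u → if nbU s v u then δ s u ∸ 1 else δ s u))
    -- v maximises k(u)/(δ(u)(δ(u)+1)) over U \ L; the fractions are compared by
    -- cross-multiplication (all denominators are positive in this case, since
    -- δ(u) ≥ k(u) ≥ 1 for u ∈ U \ L).
    case3 : (∀ u → u ∈ U s → ¬ (k s u ≡ 0)) →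
      (∀ u → u ∈ U s → u ∉ L s → ¬ (δ s u < k s u)) →
      (v : Fin n) → v ∈ U s → v ∉ L s →
      (∀ u → u ∈ U s → u ∉ L s →
         k s u * (δ s v * suc (δ s v)) ≤ k s v * (δ s u * suc (δ s u))) →
      Step s (state (S s) (L s ∪ ⁅ v ⁆) (U s) (k s)
                (λ u → if nbU s v u then δ s u ∸ 1 else δ s u))

  data RunFrom (s : State n) : Subset n → Set where
    done : U s ≡ ⊥ → RunFrom s (S s)
    step : ∀ {s' R} → Step s s' → RunFrom s' R → RunFrom s R

  MTSReturns : (Fin n → ℕ) → Subset n → Set
  MTSReturns t R = RunFrom (initState t) R

-- Two facts hold along every run of MTS: δ(v) counts the neighbours of v in U ∖ L, and k(v) is t(v)
-- minus the number of neighbours of v already removed from U. Hence a node removed by Case 1 becomes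
-- active one round after its removed neighbours, and the returned S is a target set. For thresholds
-- 2 a target set on n ≥ 2 nodes has at least two nodes, so it suffices that on a Dirac graph Case 2
-- fires at most twice.
--
-- Until the first Case 2 every k equals 2, so Case 3 deletes from W = U ∖ L a node of minimum
-- degree; this does not increase the Caro–Wei sum Φ(W) = Σ_{u ∈ W} 2/(deg_W u + 1), and Φ(V) < 4
-- by Dirac's condition. Let W₁ be W when the first seed v₁ is chosen (so deg_{W₁} v₁ ≤ 1) and v₂
-- the second seed. At a third Case 2 every node of U has at most one removed neighbour, and double
-- counting the edges leaving the removed set against Dirac's condition shows that the removed set is
-- a clique and, having at least three elements, that v₂ has at most one neighbour in U. So v₁ ~ v₂
-- and v₂ has at most one neighbour in W₁ ∖ v₁. With none, v₁v₂ is an isolated edge of W₁ and the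
-- rest of W₁ contributes at least 2, so Φ(W₁) ≥ 4; with one, v₂ was neither chosen by Case 2 right
-- away (δ = 1 = k) nor preceded by a Case-3 choice z, whose ratio k/(δ(δ+1)) ≤ 2/6 is below 1/2.

module Submission where

open import Defs
open import Data.Nat using (ℕ; zero; suc; _+_; _*_; _∸_; _⊓_; _≤_; _<_; z≤n; s≤s; _≤?_; _!; NonZero; >-nonZero)
open import Data.Nat.Properties hiding (_≟_; suc-injective)
open import Data.Nat.DivMod using (_/_; m/n*n≡m; m*n/n≡m; /-monoʳ-≤)
open import Data.Nat.Divisibility using (_∣_; divides; m≤n⇒m!∣n!; ∣-trans; m∣m*n)
open import Data.Nat.Tactic.RingSolver using (solve-∀)
open import Data.Bool using (Bool; true; false; _∧_; _∨_; not; if_then_else_)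
open import Data.Bool.Properties
  using (∧-zeroʳ; ∧-identityʳ; ∧-assoc; ∧-comm; ∨-zeroʳ; ∧-conicalˡ; ∧-conicalʳ; not-involutive)
open import Data.Fin using (Fin; zero; suc)
open import Data.Fin.Properties using (_≟_; suc-injective)
open import Data.Fin.Subset using (Subset; ⊥; ⊤; ⁅_⁆; _∪_; _∩_; _-_; _─_; ∣_∣; _∈_; _∉_)
open import Data.Fin.Subset.Properties using (∣p∣≤n)
open import Data.Vec using ([]; _∷_; lookup; tabulate)
open import Data.Vec.Properties using (lookup-zipWith; lookup-replicate; lookup∘tabulate; []=⇒lookup; lookup⇒[]=)
open import Data.Product using (∃; _×_; _,_; proj₁; proj₂)
open import Data.Sum using (_⊎_; inj₁; inj₂)
open import Data.Empty using (⊥-elim) renaming (⊥ to Empty)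
open import Relation.Nullary using (¬_; yes; no)
open import Relation.Nullary.Decidable using (⌊_⌋)
open import Relation.Binary.PropositionalEquality
open import Algebra.Properties.CommutativeSemigroup +-commutativeSemigroup using (x∙yz≈y∙xz; xy∙z≈xz∙y)
open import Function using (_∘_)
open import Algebra.Properties.Semiring.Sum +-*-semiring
  using (sum; sum-cong-≗; ∑-distrib-+; ∑-comm; *-distribˡ-sum; *-distribʳ-sum)

true≢false : ¬ true ≡ false
true≢false ()

bit : Bool → ℕ
bit true = 1
bit false = 0

bit≤1 : ∀ b → bit b ≤ 1
bit≤1 true = s≤s z≤n
bit≤1 false = z≤n

bit-mono : ∀ {a b} → (a ≡ true → b ≡ true) → bit a ≤ bit b
bit-mono {false} h = z≤n
bit-mono {true} h rewrite h refl = ≤-refl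

_==_ : ∀ {n} → Fin n → Fin n → Bool
i == j = ⌊ i ≟ j ⌋

==-refl : ∀ {n} (i : Fin n) → (i == i) ≡ true
==-refl i with i ≟ i
... | yes _ = refl
... | no i≢i = ⊥-elim (i≢i refl)

==⇒≡ : ∀ {n} {i j : Fin n} → (i == j) ≡ true → i ≡ j
==⇒≡ {i = i} {j} e with i ≟ j
... | yes i≡j = i≡j

≢⇒==false : ∀ {n} {i j : Fin n} → ¬ i ≡ j → (i == j) ≡ false
≢⇒==false {i = i} {j} i≢j with i ≟ j
... | yes i≡j = ⊥-elim (i≢j i≡j)
... | no _ = refl

==-suc : ∀ {n} (i j : Fin n) → (i == j) ≡ (suc i == suc j)
==-suc i j with i ≟ j | suc i ≟ suc j
... | yes _ | yes _ = refl
... | no _ | no _ = refl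
... | yes i≡j | no si≢sj = ⊥-elim (si≢sj (cong suc i≡j))
... | no i≢j | yes si≡sj = ⊥-elim (i≢j (suc-injective si≡sj))

_∖_ : ∀ {n} → (Fin n → Bool) → Fin n → Fin n → Bool
(X ∖ v) w = X w ∧ not (v == w)

∖⇒∈ : ∀ {n} {X : Fin n → Bool} {v w} → (X ∖ v) w ≡ true → X w ≡ true
∖⇒∈ {X = X} {w = w} = ∧-conicalˡ (X w) _

∖⇒≢ : ∀ {n} {X : Fin n → Bool} {v w} → (X ∖ v) w ≡ true → ¬ w ≡ v
∖⇒≢ {X = X} {v} e refl with () ← trans (sym e) (trans (cong (λ b → X v ∧ not b) (==-refl v)) (∧-zeroʳ (X v)))

∈∖ : ∀ {n} {X : Fin n → Bool} {v w} → X w ≡ true → ¬ w ≡ v → (X ∖ v) w ≡ true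
∈∖ {v = v} {w} w∈X w≢v rewrite w∈X | ≢⇒==false (λ v≡w → w≢v (sym v≡w)) = refl

∉∖ : ∀ {n} (X : Fin n → Bool) v → (X ∖ v) v ≡ false
∉∖ X v rewrite ==-refl v = ∧-zeroʳ (X v)

sum-mono : ∀ {n} {f g : Fin n → ℕ} → (∀ i → f i ≤ g i) → sum f ≤ sum g
sum-mono {zero} f≤g = z≤n
sum-mono {suc n} f≤g = +-mono-≤ (f≤g zero) (sum-mono (f≤g ∘ suc))

sum-const : ∀ {n} c → sum {n} (λ _ → c) ≡ n * c
sum-const {zero} c = refl
sum-const {suc n} c = cong (c +_) (sum-const {n} c)

sum-*ʳ : ∀ {n} (f : Fin n → ℕ) c → sum (λ i → f i * c) ≡ sum f * c
sum-*ʳ f c = sym (*-distribʳ-sum c f)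

sum-*ˡ : ∀ {n} c (f : Fin n → ℕ) → sum (λ i → c * f i) ≡ c * sum f
sum-*ˡ c f = sym (*-distribˡ-sum c f)

-- Splitting off the i-th summand without leaving Fin n: the rest is masked to 0.
sum-pick : ∀ {n} (f : Fin n → ℕ) (i : Fin n) →
  sum f ≡ f i + sum (λ j → if i == j then 0 else f j)
sum-pick {suc n} f zero =
  cong (f zero +_) (sum-cong-≗ λ j → cong (λ b → if b then 0 else f (suc j)) (sym (≢⇒==false {i = zero} {suc j} λ ())))
sum-pick {suc n} f (suc i) = begin
    f zero + sum (f ∘ suc)
  ≡⟨ cong (f zero +_) (sum-pick (f ∘ suc) i) ⟩
    f zero + (f (suc i) + rest)
  ≡⟨ x∙yz≈y∙xz (f zero) (f (suc i)) rest ⟩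
    f (suc i) + (f zero + rest)
  ≡⟨ cong₂ (λ b c → f (suc i) + ((if b then 0 else f zero) + c))
           (sym (≢⇒==false {i = suc i} {zero} λ ()))
           (sum-cong-≗ λ j → cong (λ b → if b then 0 else f (suc j)) (==-suc i j)) ⟩
    f (suc i) + sum (λ j → if suc i == j then 0 else f j)
  ∎
  where
  open ≡-Reasoning
  rest = sum (λ j → if i == j then 0 else f (suc j))

sum-<-pick : ∀ {n} {f g : Fin n → ℕ} (i : Fin n) e →
  (∀ j → g j ≤ f j) → g i + e ≤ f i → sum g + e ≤ sum f
sum-<-pick {f = f} {g} i e g≤f gi+e≤fi = begin
    sum g + e
  ≡⟨ cong (_+ e) (sum-pick g i) ⟩
    g i + rest g + e
  ≡⟨ xy∙z≈xz∙y (g i) (rest g) e ⟩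
    g i + e + rest g
  ≤⟨ +-mono-≤ gi+e≤fi (sum-mono masked≤) ⟩
    f i + rest f
  ≡⟨ sym (sum-pick f i) ⟩
    sum f
  ∎
  where
  open ≤-Reasoning
  rest : (Fin _ → ℕ) → ℕ
  rest h = sum (λ j → if i == j then 0 else h j)
  masked≤ : ∀ j → (if i == j then 0 else g j) ≤ (if i == j then 0 else f j)
  masked≤ j with i == j
  ... | true = z≤n
  ... | false = g≤f j

count : ∀ {n} → (Fin n → Bool) → ℕ
count p = sum (bit ∘ p)

count-cong : ∀ {n} {p q : Fin n → Bool} → (∀ i → p i ≡ q i) → count p ≡ count q
count-cong p≗q = sum-cong-≗ (cong bit ∘ p≗q)

count-mono : ∀ {n} {p q : Fin n → Bool} → (∀ i → p i ≡ true → q i ≡ true) → count p ≤ count q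
count-mono p⊆q = sum-mono (λ i → bit-mono (p⊆q i))

count-*ʳ : ∀ {n} (p : Fin n → Bool) c → sum (λ i → bit (p i) * c) ≡ count p * c
count-*ʳ p = sum-*ʳ (bit ∘ p)

count≤n : ∀ {n} (p : Fin n → Bool) → count p ≤ n
count≤n {n} p = ≤-trans (sum-mono (bit≤1 ∘ p)) (≤-reflexive (trans (sum-const {n} 1) (*-identityʳ n)))

count-all : ∀ {n} {p : Fin n → Bool} → (∀ i → p i ≡ true) → count p ≡ n
count-all {n} all = trans (count-cong all) (trans (sum-const {n} 1) (*-identityʳ n))

count-none : ∀ {n} {p : Fin n → Bool} → (∀ i → p i ≡ false) → count p ≡ 0
count-none {n} none = trans (count-cong none) (trans (sum-const {n} 0) (*-zeroʳ n))

count-pick : ∀ {n} (p : Fin n → Bool) (i : Fin n) →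
  count p ≡ bit (p i) + count (p ∖ i)
count-pick p i = trans (sum-pick (bit ∘ p) i) (cong (bit (p i) +_) (sum-cong-≗ masked))
  where
  masked : ∀ j → (if i == j then 0 else bit (p j)) ≡ bit (p j ∧ not (i == j))
  masked j with i == j
  ... | true = cong bit (sym (∧-zeroʳ (p j)))
  ... | false = cong bit (sym (∧-identityʳ (p j)))

count-remove : ∀ {n} (p : Fin n → Bool) {i} → p i ≡ true → count p ≡ suc (count (p ∖ i))
count-remove p {i} pi = trans (count-pick p i) (cong (λ b → bit b + count (p ∖ i)) pi)

count≥1 : ∀ {n} (p : Fin n → Bool) {i} → p i ≡ true → 1 ≤ count p
count≥1 p pi = ≤-trans (s≤s z≤n) (≤-reflexive (sym (count-remove p pi)))

count≥1⇒∃ : ∀ {n} (p : Fin n → Bool) → 1 ≤ count p → ∃ λ i → p i ≡ true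
count≥1⇒∃ {suc n} p 1≤ with p zero in p0
... | true = zero , p0
... | false with count≥1⇒∃ (p ∘ suc) 1≤
... | i , pi = suc i , pi

count-single : ∀ {n} (v : Fin n) → count (v ==_) ≡ 1
count-single v = trans (count-pick (v ==_) v) (cong₂ _+_ (cong bit (==-refl v)) (count-none p∧¬p))
  where
  p∧¬p : ∀ j → ((v == j) ∧ not (v == j)) ≡ false
  p∧¬p j with v == j
  ... | true = refl
  ... | false = refl

count-∨ : ∀ {n} (p q : Fin n → Bool) → count (λ i → p i ∨ q i) ≤ count p + count q
count-∨ p q = ≤-trans (sum-mono (λ i → bit-∨ (p i) (q i))) (≤-reflexive (∑-distrib-+ (bit ∘ p) (bit ∘ q)))
  where
  bit-∨ : ∀ a b → bit (a ∨ b) ≤ bit a + bit b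
  bit-∨ false b = ≤-refl
  bit-∨ true b = s≤s z≤n

count-split : ∀ {n} (p q : Fin n → Bool) →
  count p ≡ count (λ i → p i ∧ q i) + count (λ i → p i ∧ not (q i))
count-split p q =
  trans (sum-cong-≗ (λ i → bit-split (p i) (q i))) (∑-distrib-+ (λ i → bit (p i ∧ q i)) (λ i → bit (p i ∧ not (q i))))
  where
  bit-split : ∀ a b → bit a ≡ bit (a ∧ b) + bit (a ∧ not b)
  bit-split false b = refl
  bit-split true false = refl
  bit-split true true = refl

count-compl : ∀ {n} (p : Fin n → Bool) → count p + count (not ∘ p) ≡ n
count-compl {n} p = trans (sym (count-split (λ _ → true) p)) (count-all {n} (λ _ → refl))

count-<-pick : ∀ {n} {p q : Fin n → Bool} (a : Fin n) →
  (∀ w → q w ≡ true → p w ≡ true) → p a ≡ true → q a ≡ false → suc (count q) ≤ count p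
count-<-pick {p = p} {q} a q⊆p pa qa = ≤-trans (s≤s (count-mono q⊆p∖a)) (≤-reflexive (sym (count-remove p pa)))
  where
  q⊆p∖a : ∀ w → q w ≡ true → (p ∖ a) w ≡ true
  q⊆p∖a w qw = ∈∖ {X = p} (q⊆p w qw) λ { refl → true≢false (trans (sym qw) qa) }

count-<-pick₂ : ∀ {n} {p q : Fin n → Bool} (a b : Fin n) →
  (∀ w → q w ≡ true → p w ≡ true) → p a ≡ true → p b ≡ true → ¬ a ≡ b →
  q a ≡ false → q b ≡ false → 2 + count q ≤ count p
count-<-pick₂ {p = p} {q} a b q⊆p pa pb a≢b qa qb =
  ≤-trans (s≤s (count-<-pick {p = p ∖ b} a q⊆p∖b (∈∖ {X = p} pa a≢b) qa))
    (count-<-pick b (λ w → ∖⇒∈ {X = p}) pb (∉∖ p b))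
  where
  q⊆p∖b : ∀ w → q w ≡ true → (p ∖ b) w ≡ true
  q⊆p∖b w qw = ∈∖ {X = p} (q⊆p w qw) λ { refl → true≢false (trans (sym qw) qb) }

count≥2 : ∀ {n} (p : Fin n → Bool) {i j : Fin n} → p i ≡ true → p j ≡ true → ¬ i ≡ j → 2 ≤ count p
count≥2 p {i} {j} pi pj i≢j =
  ≤-trans (s≤s (count≥1 (p ∖ i) (∈∖ {X = p} pj (λ j≡i → i≢j (sym j≡i))))) (≤-reflexive (sym (count-remove p pi)))

lookup-∪ : ∀ {n} (p q : Subset n) i → lookup (p ∪ q) i ≡ (lookup p i ∨ lookup q i)
lookup-∪ p q i = lookup-zipWith _∨_ i p q

lookup-∩ : ∀ {n} (p q : Subset n) i → lookup (p ∩ q) i ≡ (lookup p i ∧ lookup q i)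
lookup-∩ p q i = lookup-zipWith _∧_ i p q

lookup-─ : ∀ {n} (p q : Subset n) i → lookup (p ─ q) i ≡ (lookup p i ∧ not (lookup q i))
lookup-─ (x ∷ p) (y ∷ q) zero with x | y
... | true | true = refl
... | true | false = refl
... | false | true = refl
... | false | false = refl
lookup-─ (x ∷ p) (y ∷ q) (suc i) = lookup-─ p q i

lookup-⁅⁆ : ∀ {n} (v i : Fin n) → lookup ⁅ v ⁆ i ≡ (v == i)
lookup-⁅⁆ zero zero = refl
lookup-⁅⁆ zero (suc i) = lookup-replicate i false
lookup-⁅⁆ (suc v) zero = refl
lookup-⁅⁆ (suc v) (suc i) = trans (lookup-⁅⁆ v i) (==-suc v i)

lookup-- : ∀ {n} (p : Subset n) v i → lookup (p - v) i ≡ (lookup p i ∧ not (v == i))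
lookup-- p v i = trans (lookup-─ p ⁅ v ⁆ i) (cong (λ b → lookup p i ∧ not b) (lookup-⁅⁆ v i))

lookup-⊥ : ∀ {n} (i : Fin n) → lookup ⊥ i ≡ false
lookup-⊥ i = lookup-replicate i false

lookup-⊤ : ∀ {n} (i : Fin n) → lookup ⊤ i ≡ true
lookup-⊤ i = lookup-replicate i true

lookup-∪⁅⁆ : ∀ {n} (p : Subset n) v → lookup (p ∪ ⁅ v ⁆) v ≡ true
lookup-∪⁅⁆ p v rewrite lookup-∪ p ⁅ v ⁆ v | lookup-⁅⁆ v v | ==-refl v = ∨-zeroʳ (lookup p v)

∈⇒lookup : ∀ {n} {p : Subset n} {x} → x ∈ p → lookup p x ≡ true
∈⇒lookup = []=⇒lookup

lookup⇒∈ : ∀ {n} {p : Subset n} {x} → lookup p x ≡ true → x ∈ p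
lookup⇒∈ {p = p} {x} = lookup⇒[]= x p

∉⇒lookup : ∀ {n} {p : Subset n} {x} → x ∉ p → lookup p x ≡ false
∉⇒lookup {p = p} {x} x∉p with lookup p x in px
... | false = refl
... | true = ⊥-elim (x∉p (lookup⇒∈ px))

∣p∣≡count : ∀ {n} (p : Subset n) → ∣ p ∣ ≡ count (lookup p)
∣p∣≡count [] = refl
∣p∣≡count (true ∷ p) = cong suc (∣p∣≡count p)
∣p∣≡count (false ∷ p) = ∣p∣≡count p

suc∣! : ∀ a N → suc a ≤ N → suc a ∣ N !
suc∣! a N a<N = ∣-trans (m∣m*n (a !)) (m≤n⇒m!∣n! a<N)

suc*suc∣! : ∀ d N → suc (suc d) ≤ N → suc d * suc (suc d) ∣ N !
suc*suc∣! d N 1+d<N = ∣-trans (divides (d !) (unfold d (d !))) (m≤n⇒m!∣n! 1+d<N)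
  where
  unfold : ∀ d x → suc (suc d) * (suc d * x) ≡ x * (suc d * suc (suc d))
  unfold = solve-∀

module _ (K d : ℕ) (dv : suc d * suc (suc d) ∣ K) where
  private
    q = K / (suc d * suc (suc d))
    K≡q*prod : K ≡ q * (suc d * suc (suc d))
    K≡q*prod = sym (m/n*n≡m dv)
    K/[d+2]≡q*[d+1] : K / suc (suc d) ≡ q * suc d
    K/[d+2]≡q*[d+1] =
      trans (cong (_/ suc (suc d)) (trans K≡q*prod (sym (*-assoc q (suc d) _)))) (m*n/n≡m (q * suc d) (suc (suc d)))

  /-telescope : K / suc d ≡ K / suc (suc d) + K / (suc d * suc (suc d))
  /-telescope = begin
      K / suc d
    ≡⟨ cong (_/ suc d) (trans K≡q*prod (reassoc q (suc d) (suc (suc d)))) ⟩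
      q * suc (suc d) * suc d / suc d
    ≡⟨ m*n/n≡m (q * suc (suc d)) (suc d) ⟩
      q * suc (suc d)
    ≡⟨ trans (*-suc q (suc d)) (+-comm q (q * suc d)) ⟩
      q * suc d + q
    ≡⟨ cong (_+ q) (sym K/[d+2]≡q*[d+1]) ⟩
      K / suc (suc d) + q
    ∎
    where
    open ≡-Reasoning
    reassoc : ∀ q a b → q * (a * b) ≡ q * b * a
    reassoc = solve-∀

  suc*/suc*suc : suc d * (K / (suc d * suc (suc d))) ≡ K / suc (suc d)
  suc*/suc*suc = trans (*-comm (suc d) q) (sym K/[d+2]≡q*[d+1])

/-gain≤ : ∀ K d δ → d ≤ δ → suc δ * suc (suc δ) ∣ K →
  2 * (K / suc δ) ≤ 2 * (K / suc (suc δ)) + 2 * (K / (suc d * suc (suc d)))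
/-gain≤ K d δ d≤δ dv = begin
    2 * (K / suc δ)
  ≡⟨ cong (2 *_) (/-telescope K δ dv) ⟩
    2 * (K / suc (suc δ) + K / (suc δ * suc (suc δ)))
  ≡⟨ *-distribˡ-+ 2 (K / suc (suc δ)) _ ⟩
    2 * (K / suc (suc δ)) + 2 * (K / (suc δ * suc (suc δ)))
  ≤⟨ +-monoʳ-≤ (2 * (K / suc (suc δ))) (*-monoʳ-≤ 2 (/-monoʳ-≤ K (*-mono-≤ (s≤s d≤δ) (s≤s (s≤s d≤δ))))) ⟩
    2 * (K / suc (suc δ)) + 2 * (K / (suc d * suc (suc d)))
  ∎
  where open ≤-Reasoning

2m+r≤2[x+y]⇒r+2c≤2x : ∀ m r x y c → 2 * m + r ≤ 2 * (x + y) → c + y ≤ m → r + 2 * c ≤ 2 * x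
2m+r≤2[x+y]⇒r+2c≤2x m r x y c dirac c+y≤m = +-cancelʳ-≤ (2 * y) (r + 2 * c) (2 * x) (begin
    r + 2 * c + 2 * y
  ≡⟨ shuffle r c y ⟩
    r + 2 * (c + y)
  ≤⟨ +-monoʳ-≤ r (*-monoʳ-≤ 2 c+y≤m) ⟩
    r + 2 * m
  ≡⟨ +-comm r (2 * m) ⟩
    2 * m + r
  ≤⟨ dirac ⟩
    2 * (x + y)
  ≡⟨ *-distribˡ-+ 2 x y ⟩
    2 * x + 2 * y
  ∎)
  where
  open ≤-Reasoning
  shuffle : ∀ r c y → r + 2 * c + 2 * y ≡ r + 2 * (c + y)
  shuffle = solve-∀

u+m≡n⇒2m≤n : ∀ n m u x y → n ≤ 2 * (x + y) → suc x ≤ u → y ≤ 1 → u + m ≡ n → 2 * m ≤ n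
u+m≡n⇒2m≤n n m u x y n≤2[x+y] x<u y≤1 u+m≡n = begin
    2 * m
  ≡⟨ cong (m +_) (+-identityʳ m) ⟩
    m + m
  ≤⟨ +-monoˡ-≤ m m≤u ⟩
    u + m
  ≡⟨ u+m≡n ⟩
    n
  ∎
  where
  open ≤-Reasoning
  x+y≤u : x + y ≤ u
  x+y≤u = ≤-trans (+-monoʳ-≤ x y≤1) (≤-trans (≤-reflexive (+-comm x 1)) x<u)
  m≤u : m ≤ u
  m≤u = +-cancelˡ-≤ u m u (begin
      u + m
    ≡⟨ u+m≡n ⟩
      n
    ≤⟨ n≤2[x+y] ⟩
      2 * (x + y)
    ≤⟨ *-monoʳ-≤ 2 x+y≤u ⟩
      2 * u
    ≡⟨ cong (u +_) (+-identityʳ u) ⟩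
      u + u
    ∎)

m[r+2]≡2[m+r]+rj : ∀ j r → (2 + j) * (r + 2) ≡ 2 * ((2 + j) + r) + r * j
m[r+2]≡2[m+r]+rj = solve-∀

m[r+2]+2≰2[m+r] : ∀ m r → 2 ≤ m → ¬ (m * (r + 2) + 2 ≤ 2 * (m + r))
m[r+2]+2≰2[m+r] (suc (suc j)) r (s≤s (s≤s z≤n)) le = <-irrefl refl (begin-strict
    2 * (2 + j + r)
  <⟨ m<m+n (2 * (2 + j + r)) {r * j + 2} (≤-trans (s≤s z≤n) (m≤n+m 2 (r * j))) ⟩
    2 * (2 + j + r) + (r * j + 2)
  ≡⟨ sym (trans (cong (_+ 2) (m[r+2]≡2[m+r]+rj j r)) (+-assoc (2 * (2 + j + r)) (r * j) 2)) ⟩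
    (2 + j) * (r + 2) + 2
  ≤⟨ le ⟩
    2 * (2 + j + r)
  ∎)
  where open ≤-Reasoning

m[r+2]≤2[m+r]⇒r≡0 : ∀ m r → 3 ≤ m → m * (r + 2) ≤ 2 * (m + r) → r ≡ 0
m[r+2]≤2[m+r]⇒r≡0 (suc (suc (suc j))) r (s≤s (s≤s (s≤s z≤n))) le = n≤0⇒n≡0 (begin
    r
  ≤⟨ m≤m*n r (suc j) ⟩
    r * suc j
  ≤⟨ +-cancelˡ-≤ (2 * (3 + j + r)) (r * suc j) 0 (begin
        2 * (3 + j + r) + r * suc j
      ≡⟨ sym (m[r+2]≡2[m+r]+rj (suc j) r) ⟩
        (3 + j) * (r + 2)
      ≤⟨ le ⟩
        2 * (3 + j + r)
      ≡⟨ sym (+-identityʳ _) ⟩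
        2 * (3 + j + r) + 0
      ∎) ⟩
    0
  ∎)
  where open ≤-Reasoning

1≤2∸ : ∀ c → c ≤ 1 → 1 ≤ 2 ∸ c
1≤2∸ zero _ = s≤s z≤n
1≤2∸ (suc zero) _ = s≤s z≤n
1≤2∸ (suc (suc c)) (s≤s ())

2∸≤1 : ∀ c → 1 ≤ c → 2 ∸ c ≤ 1
2∸≤1 (suc c) _ = m∸n≤m 1 c

2∸c≢0⇒c≤1 : ∀ c → ¬ 2 ∸ c ≡ 0 → c ≤ 1
2∸c≢0⇒c≤1 zero _ = z≤n
2∸c≢0⇒c≤1 (suc zero) _ = s≤s z≤n
2∸c≢0⇒c≤1 (suc (suc c)) 2∸c≢0 = ⊥-elim (2∸c≢0 (0∸n≡0 c))

m[1+m]≤n[1+n]⇒m≤n : ∀ a b → a * suc a ≤ b * suc b → a ≤ b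
m[1+m]≤n[1+n]⇒m≤n a b le with a ≤? b
... | yes a≤b = a≤b
... | no a≰b = ⊥-elim (<⇒≱ (*-mono-< (≰⇒> a≰b) (s≤s (≰⇒> a≰b))) le)

∧-true : ∀ {a b} → a ≡ true → b ≡ true → (a ∧ b) ≡ true
∧-true refl refl = refl

∧-monoʳ : ∀ a {x y} → (x ≡ true → y ≡ true) → (a ∧ x) ≡ true → (a ∧ y) ≡ true
∧-monoʳ true x⇒y = x⇒y

if-∸1 : ∀ b x y → x ≡ bit b + y → (if b then x ∸ 1 else x) ≡ y
if-∸1 true x y x≡1+y = cong (_∸ 1) x≡1+y
if-∸1 false x y x≡y = x≡y

if-∸1-∸ : ∀ b t c → (if b then (t ∸ c) ∸ 1 else t ∸ c) ≡ t ∸ (bit b + c)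
if-∸1-∸ true t c = trans (∸-+-assoc t c 1) (cong (t ∸_) (+-comm c 1))
if-∸1-∸ false t c = refl

-- Invariants of MTS and the returned target set

module _ {n : ℕ} (G : Graph n) where

  degIn : Fin n → (Fin n → Bool) → ℕ
  degIn u X = count (λ w → adj G w u ∧ X w)

  degIn-cong : ∀ u {X Y : Fin n → Bool} → (∀ w → X w ≡ Y w) → degIn u X ≡ degIn u Y
  degIn-cong u X≗Y = count-cong (λ w → cong (adj G w u ∧_) (X≗Y w))

  degIn-mono : ∀ u {X Y : Fin n → Bool} → (∀ w → X w ≡ true → Y w ≡ true) → degIn u X ≤ degIn u Y
  degIn-mono u X⊆Y = count-mono (λ w → ∧-monoʳ (adj G w u) (X⊆Y w))

  degIn-none : ∀ u {X : Fin n → Bool} → (∀ w → X w ≡ false) → degIn u X ≡ 0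
  degIn-none u none = count-none (λ w → trans (cong (adj G w u ∧_) (none w)) (∧-zeroʳ (adj G w u)))

  degIn≥1 : ∀ u {X : Fin n → Bool} {w} → adj G w u ≡ true → X w ≡ true → 1 ≤ degIn u X
  degIn≥1 u {X} w~u w∈X = count≥1 (λ w → adj G w u ∧ X w) (∧-true w~u w∈X)

  degIn≥2 : ∀ u {X : Fin n → Bool} {a b} → ¬ a ≡ b →
    adj G a u ≡ true → X a ≡ true → adj G b u ≡ true → X b ≡ true → 2 ≤ degIn u X
  degIn≥2 u {X} a≢b a~u a∈X b~u b∈X = count≥2 (λ w → adj G w u ∧ X w) (∧-true a~u a∈X) (∧-true b~u b∈X) a≢b

  degIn-single≤1 : ∀ u v → degIn u (v ==_) ≤ 1
  degIn-single≤1 u v = ≤-trans (count-mono (λ w → ∧-conicalʳ (adj G w u) _)) (≤-reflexive (count-single v))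

  degIn-∖ : ∀ u X v → degIn u X ≡ bit (adj G v u ∧ X v) + degIn u (X ∖ v)
  degIn-∖ u X v = trans (count-pick (λ w → adj G w u ∧ X w) v)
    (cong (bit (adj G v u ∧ X v) +_) (count-cong (λ w → ∧-assoc (adj G w u) (X w) _)))

  degIn<count : ∀ (X : Fin n → Bool) u → X u ≡ true → suc (degIn u X) ≤ count X
  degIn<count X u u∈X = count-<-pick u (λ w → ∧-conicalʳ (adj G w u) (X w)) u∈X (cong (_∧ X u) (loopless G u))

  degIn<n : ∀ u X → suc (degIn u X) ≤ n
  degIn<n u X = ≤-trans (count-<-pick u (λ _ _ → refl) refl (cong (_∧ X u) (loopless G u))) (count≤n (λ _ → true))

  deg≡degIn-all : ∀ u → deg G u ≡ degIn u (λ _ → true)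
  deg≡degIn-all u = trans (∣p∣≡count (Γin G u))
    (count-cong λ w → trans (lookup∘tabulate (λ x → adj G x u) w) (sym (∧-identityʳ (adj G w u))))

  count-adj : ∀ (X : Fin n → Bool) x → count (λ u → X u ∧ adj G x u) ≡ degIn x X
  count-adj X x = count-cong λ u → trans (∧-comm (X u) (adj G x u)) (cong (_∧ X u) (adj-sym G x u))

  inU inL inS : State n → Fin n → Bool
  inU s = lookup (U s)
  inL s = lookup (L s)
  inS s = lookup (S s)

  U∖L Uᶜ : State n → Fin n → Bool
  U∖L s i = inU s i ∧ not (inL s i)
  Uᶜ s i = not (inU s i)

  ∈U∖L : ∀ s {u} → u ∈ U s → u ∉ L s → U∖L s u ≡ true
  ∈U∖L s {u} u∈U u∉L rewrite ∈⇒lookup u∈U | ∉⇒lookup u∉L = refl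

  U∖L⇒∈U : ∀ s {u} → U∖L s u ≡ true → u ∈ U s
  U∖L⇒∈U s {u} u∈ = lookup⇒∈ (∧-conicalˡ (inU s u) _ u∈)

  U∖L⇒∉L : ∀ s {u} → U∖L s u ≡ true → u ∉ L s
  U∖L⇒∉L s {u} u∈ u∈L =
    true≢false (trans (sym u∈) (trans (cong (λ b → inU s u ∧ not b) (∈⇒lookup u∈L)) (∧-zeroʳ (inU s u))))

  record Invariant (t : Fin n → ℕ) (s : State n) : Set where
    field
      δ≡degIn-U∖L : ∀ u → inU s u ≡ true → δ s u ≡ degIn u (U∖L s)
      k≡t∸degIn-Uᶜ : ∀ u → inU s u ≡ true → k s u ≡ t u ∸ degIn u (Uᶜ s)
      S∩U≡∅ : ∀ u → inS s u ≡ true → inU s u ≡ false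
  open Invariant public

  invariant-init : ∀ t → Invariant t (initState G t)
  invariant-init t = record
    { δ≡degIn-U∖L = λ u _ → trans (deg≡degIn-all u)
        (degIn-cong u (λ w → cong₂ (λ a b → a ∧ not b) (sym (lookup-⊤ w)) (sym (lookup-⊥ w))))
    ; k≡t∸degIn-Uᶜ = λ u _ → cong (t u ∸_) (sym (degIn-none u (λ w → cong not (lookup-⊤ w))))
    ; S∩U≡∅ = λ u u∈S → ⊥-elim (true≢false (trans (sym u∈S) (lookup-⊥ u)))
    }

  ∈U-v⇒∈U : ∀ (s : State n) v u → lookup (U s - v) u ≡ true → inU s u ≡ true
  ∈U-v⇒∈U s v u u∈U-v = ∖⇒∈ {X = inU s} (trans (sym (lookup-- (U s) v u)) u∈U-v)

  ∉U-v⇒ : ∀ (s : State n) v u → lookup (U s - v) u ≡ false → inU s u ≡ false ⊎ u ≡ v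
  ∉U-v⇒ s v u u∉U-v with inU s u in u∈U | v == u in v=u
  ... | false | _ = inj₁ refl
  ... | true | true = inj₂ (sym (==⇒≡ v=u))
  ... | true | false = ⊥-elim (true≢false
    (trans (sym (cong₂ (λ a b → a ∧ not b) u∈U v=u)) (trans (sym (lookup-- (U s) v u)) u∉U-v)))

  degIn-Uᶜ-remove : ∀ (s : State n) v u → inU s v ≡ true →
    degIn u (not ∘ lookup (U s - v)) ≡ bit (adj G v u) + degIn u (Uᶜ s)
  degIn-Uᶜ-remove s v u v∈U = begin
      degIn u Uᶜ'
    ≡⟨ degIn-∖ u Uᶜ' v ⟩
      bit (adj G v u ∧ Uᶜ' v) + degIn u (Uᶜ' ∖ v)
    ≡⟨ cong₂ (λ b c → bit b + c) v∈Uᶜ' (degIn-cong u Uᶜ'∖v≗Uᶜ) ⟩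
      bit (adj G v u) + degIn u (Uᶜ s)
    ∎
    where
    open ≡-Reasoning
    Uᶜ' : Fin n → Bool
    Uᶜ' = not ∘ lookup (U s - v)
    v∈Uᶜ' : (adj G v u ∧ Uᶜ' v) ≡ adj G v u
    v∈Uᶜ' rewrite lookup-- (U s) v v | v∈U | ==-refl v = ∧-identityʳ (adj G v u)
    Uᶜ'∖v≗Uᶜ : ∀ w → (Uᶜ' ∖ v) w ≡ Uᶜ s w
    Uᶜ'∖v≗Uᶜ w rewrite lookup-- (U s) v w with v == w in v=w
    ... | true rewrite sym (==⇒≡ v=w) | v∈U = refl
    ... | false = trans (∧-identityʳ (not (inU s w ∧ true))) (cong not (∧-identityʳ (inU s w)))

  nbU≡adj : ∀ s v u → inU s u ≡ true → nbU G s v u ≡ adj G v u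
  nbU≡adj s v u u∈U = trans (cong (adj G v u ∧_) u∈U) (∧-identityʳ (adj G v u))

  U∖L-removeU : ∀ s v w → (lookup (U s - v) w ∧ not (inL s w)) ≡ (U∖L s ∖ v) w
  U∖L-removeU s v w rewrite lookup-- (U s) v w = swap (inU s w) (not (v == w)) (not (inL s w))
    where
    swap : ∀ a b c → ((a ∧ b) ∧ c) ≡ ((a ∧ c) ∧ b)
    swap a b c = trans (∧-assoc a b c) (trans (cong (a ∧_) (∧-comm b c)) (sym (∧-assoc a c b)))

  U∖L-addL : ∀ s v w → (inU s w ∧ not (lookup (L s ∪ ⁅ v ⁆) w)) ≡ (U∖L s ∖ v) w
  U∖L-addL s v w rewrite lookup-∪ (L s) ⁅ v ⁆ w | lookup-⁅⁆ v w = deMorgan (inU s w) (inL s w) (v == w)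
    where
    deMorgan : ∀ a b c → (a ∧ not (b ∨ c)) ≡ ((a ∧ not b) ∧ not c)
    deMorgan true true c = refl
    deMorgan true false c = refl
    deMorgan false b c = refl

  δ-update : ∀ {t s} → Invariant t s → ∀ v u b → inU s u ≡ true → b ≡ (adj G v u ∧ U∖L s v) →
    (if b then δ s u ∸ 1 else δ s u) ≡ degIn u (U∖L s ∖ v)
  δ-update {s = s} I v u b u∈U b≡ = if-∸1 b _ _ (begin
      δ s u
    ≡⟨ δ≡degIn-U∖L I u u∈U ⟩
      degIn u (U∖L s)
    ≡⟨ degIn-∖ u (U∖L s) v ⟩
      bit (adj G v u ∧ U∖L s v) + degIn u (U∖L s ∖ v)
    ≡⟨ cong (λ c → bit c + degIn u (U∖L s ∖ v)) (sym b≡) ⟩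
      bit b + degIn u (U∖L s ∖ v)
    ∎)
    where open ≡-Reasoning

  k-update : ∀ {t s} → Invariant t s → ∀ v u → inU s v ≡ true → inU s u ≡ true →
    (if nbU G s v u then k s u ∸ 1 else k s u) ≡ t u ∸ degIn u (not ∘ lookup (U s - v))
  k-update {t} {s} I v u v∈U u∈U
    rewrite nbU≡adj s v u u∈U | k≡t∸degIn-Uᶜ I u u∈U | degIn-Uᶜ-remove s v u v∈U =
    if-∸1-∸ (adj G v u) (t u) (degIn u (Uᶜ s))

  nbU∧≡adj∧U∖L : ∀ s v u → inU s v ≡ true → inU s u ≡ true →
    (nbU G s v u ∧ not (inL s v)) ≡ (adj G v u ∧ U∖L s v)
  nbU∧≡adj∧U∖L s v u v∈U u∈U rewrite nbU≡adj s v u u∈U | v∈U = refl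

  nbU≡adj∧U∖L : ∀ s v u → inU s v ≡ true → inL s v ≡ false → inU s u ≡ true →
    nbU G s v u ≡ (adj G v u ∧ U∖L s v)
  nbU≡adj∧U∖L s v u v∈U v∉L u∈U rewrite nbU≡adj s v u u∈U | v∈U | v∉L = sym (∧-identityʳ (adj G v u))

  invariant-step : ∀ {t s s'} → Step G s s' → Invariant t s → Invariant t s'
  invariant-step {s = s} (case1 v v∈U _) I = record
    { δ≡degIn-U∖L = λ u u∈U' → let u∈U = ∈U-v⇒∈U s v u u∈U' in
        trans (δ-update I v u _ u∈U (nbU∧≡adj∧U∖L s v u (∈⇒lookup v∈U) u∈U)) (sym (degIn-cong u (U∖L-removeU s v)))
    ; k≡t∸degIn-Uᶜ = λ u u∈U' → k-update I v u (∈⇒lookup v∈U) (∈U-v⇒∈U s v u u∈U')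
    ; S∩U≡∅ = λ u u∈S → trans (lookup-- (U s) v u) (cong (_∧ not (v == u)) (S∩U≡∅ I u u∈S))
    }
  invariant-step {s = s} (case2 _ v v∈U v∉L _) I = record
    { δ≡degIn-U∖L = λ u u∈U' → let u∈U = ∈U-v⇒∈U s v u u∈U' in
        trans (δ-update I v u _ u∈U (nbU≡adj∧U∖L s v u (∈⇒lookup v∈U) (∉⇒lookup v∉L) u∈U))
          (sym (degIn-cong u (U∖L-removeU s v)))
    ; k≡t∸degIn-Uᶜ = λ u u∈U' → k-update I v u (∈⇒lookup v∈U) (∈U-v⇒∈U s v u u∈U')
    ; S∩U≡∅ = λ u u∈S∪v → trans (lookup-- (U s) v u) (S∪v∩U-v u (trans (sym (lookup-∪ (S s) ⁅ v ⁆ u)) u∈S∪v))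
    }
    where
    S∪v∩U-v : ∀ u → (inS s u ∨ lookup ⁅ v ⁆ u) ≡ true → (inU s u ∧ not (v == u)) ≡ false
    S∪v∩U-v u u∈S∪v rewrite lookup-⁅⁆ v u with inS s u in u∈S | v == u
    ... | true | _ rewrite S∩U≡∅ I u u∈S = refl
    ... | false | true = ∧-zeroʳ (inU s u)
  invariant-step {s = s} (case3 _ _ v v∈U v∉L _) I = record
    { δ≡degIn-U∖L = λ u u∈U →
        trans (δ-update I v u _ u∈U (nbU≡adj∧U∖L s v u (∈⇒lookup v∈U) (∉⇒lookup v∉L) u∈U))
          (sym (degIn-cong u (U∖L-addL s v)))
    ; k≡t∸degIn-Uᶜ = k≡t∸degIn-Uᶜ I
    ; S∩U≡∅ = S∩U≡∅ I
    }

  U-shrinks : ∀ {s s'} → Step G s s' → ∀ i → inU s' i ≡ true → inU s i ≡ true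
  U-shrinks {s} (case1 v _ _) i i∈U' = ∈U-v⇒∈U s v i i∈U'
  U-shrinks {s} (case2 _ v _ _ _) i i∈U' = ∈U-v⇒∈U s v i i∈U'
  U-shrinks (case3 _ _ _ _ _ _) i i∈U' = i∈U'

  Uᶜ-grows : ∀ {s s'} → Step G s s' → ∀ i → inU s i ≡ false → inU s' i ≡ false
  Uᶜ-grows {s' = s'} st i i∉U with inU s' i in i∈U'
  ... | false = refl
  ... | true = ⊥-elim (true≢false (trans (sym (U-shrinks st i i∈U')) i∉U))

  U∖L-shrinks : ∀ {s s'} → Step G s s' → ∀ i → U∖L s' i ≡ true → U∖L s i ≡ true
  U∖L-shrinks {s} (case1 v _ _) i i∈ = ∧-conicalˡ _ _ (trans (sym (U∖L-removeU s v i)) i∈)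
  U∖L-shrinks {s} (case2 _ v _ _ _) i i∈ = ∧-conicalˡ _ _ (trans (sym (U∖L-removeU s v i)) i∈)
  U∖L-shrinks {s} (case3 _ _ v _ _ _) i i∈ = ∧-conicalˡ _ _ (trans (sym (U∖L-addL s v i)) i∈)

  S-grows : ∀ {s s'} → Step G s s' → ∀ i → inS s i ≡ true → inS s' i ≡ true
  S-grows (case1 _ _ _) i i∈S = i∈S
  S-grows {s} (case2 _ v _ _ _) i i∈S rewrite lookup-∪ (S s) ⁅ v ⁆ i | i∈S = refl
  S-grows (case3 _ _ _ _ _ _) i i∈S = i∈S

  L-grows : ∀ {s s'} → Step G s s' → ∀ i → inL s i ≡ true → inL s' i ≡ true
  L-grows (case1 _ _ _) i i∈L = i∈L
  L-grows (case2 _ _ _ _ _) i i∈L = i∈L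
  L-grows {s} (case3 _ _ v _ _ _) i i∈L rewrite lookup-∪ (L s) ⁅ v ⁆ i | i∈L = refl

  S⊆result : ∀ {s R} → RunFrom G s R → ∀ i → inS s i ≡ true → lookup R i ≡ true
  S⊆result (done _) i i∈S = i∈S
  S⊆result (step st run) i i∈S = S⊆result run i (S-grows st i i∈S)

  module _ (t : Fin n → ℕ) (R : Subset n) where

    active : ℕ → Fin n → Bool
    active ℓ = lookup (Active G t R ℓ)

    active-suc : ∀ ℓ v → active ℓ v ≡ true → active (suc ℓ) v ≡ true
    active-suc ℓ v v∈Aℓ rewrite lookup-∪ (Active G t R ℓ) (tabulate (λ u → ⌊ t u ≤? ∣ Γin G u ∩ Active G t R ℓ ∣ ⌋)) v
                              | v∈Aℓ = refl

    seed-active : ∀ v → lookup R v ≡ true → ∀ ℓ → active ℓ v ≡ true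
    seed-active v v∈R zero = v∈R
    seed-active v v∈R (suc ℓ) = active-suc ℓ v (seed-active v v∈R ℓ)

    ∣Γin∩active∣ : ∀ ℓ v → ∣ Γin G v ∩ Active G t R ℓ ∣ ≡ degIn v (active ℓ)
    ∣Γin∩active∣ ℓ v = trans (∣p∣≡count (Γin G v ∩ Active G t R ℓ))
      (count-cong λ w → trans (lookup-∩ (Γin G v) (Active G t R ℓ) w)
        (cong (_∧ active ℓ w) (lookup∘tabulate (λ x → adj G x v) w)))

    active-suc⇔ : ∀ ℓ v → active (suc ℓ) v ≡ (active ℓ v ∨ ⌊ t v ≤? degIn v (active ℓ) ⌋)
    active-suc⇔ ℓ v = trans (lookup-∪ (Active G t R ℓ) _ v)
      (cong (active ℓ v ∨_) (trans (lookup∘tabulate (λ u → ⌊ t u ≤? ∣ Γin G u ∩ Active G t R ℓ ∣ ⌋) v)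
        (cong (λ x → ⌊ t v ≤? x ⌋) (∣Γin∩active∣ ℓ v))))

    threshold-active : ∀ ℓ v → t v ≤ degIn v (active ℓ) → active (suc ℓ) v ≡ true
    threshold-active ℓ v t≤ =
      trans (active-suc⇔ ℓ v) (trans (cong (active ℓ v ∨_) (≤⇒⌊≤?⌋ t≤)) (∨-zeroʳ (active ℓ v)))
      where
      ≤⇒⌊≤?⌋ : ∀ {a b} → a ≤ b → ⌊ a ≤? b ⌋ ≡ true
      ≤⇒⌊≤?⌋ {a} {b} a≤b with a ≤? b
      ... | yes _ = refl
      ... | no a≰b = ⊥-elim (a≰b a≤b)

    active⊆seeds : (∀ v → count (lookup R) < t v) → ∀ ℓ v → active ℓ v ≡ true → lookup R v ≡ true
    active⊆seeds R<t zero v v∈R = v∈R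
    active⊆seeds R<t (suc ℓ) v v∈Aℓ+1 with active ℓ v in v∈Aℓ
    ... | true = active⊆seeds R<t ℓ v v∈Aℓ
    ... | false = ⊥-elim (<⇒≱ (R<t v) (begin
        t v
      ≤⟨ ⌊≤?⌋⇒≤ (trans (sym (cong (_∨ ⌊ t v ≤? degIn v (active ℓ) ⌋) v∈Aℓ))
           (trans (sym (active-suc⇔ ℓ v)) v∈Aℓ+1)) ⟩
        degIn v (active ℓ)
      ≤⟨ degIn-mono v (active⊆seeds R<t ℓ) ⟩
        degIn v (lookup R)
      ≤⟨ count-mono (λ w → ∧-conicalʳ (adj G w v) _) ⟩
        count (lookup R)
      ∎))
      where
      open ≤-Reasoning
      ⌊≤?⌋⇒≤ : ∀ {a b} → ⌊ a ≤? b ⌋ ≡ true → a ≤ b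
      ⌊≤?⌋⇒≤ {a} {b} e with a ≤? b
      ... | yes a≤b = a≤b

    Uᶜ-active : State n → Set
    Uᶜ-active s = ∃ λ ℓ → ∀ v → inU s v ≡ false → active ℓ v ≡ true

    run-isTargetSet : ∀ {s} → RunFrom G s R → Invariant t s → Uᶜ-active s → IsTargetSet G t R
    run-isTargetSet (done U≡∅) I (ℓ , Uᶜ⊆Aℓ) =
      ℓ , λ v → lookup⇒∈ (Uᶜ⊆Aℓ v (trans (cong (λ p → lookup p v) U≡∅) (lookup-⊥ v)))
    run-isTargetSet {s} (step st@(case1 v v∈U kv≡0) run) I (ℓ , Uᶜ⊆Aℓ) =
      run-isTargetSet run (invariant-step st I) (suc ℓ , Uᶜ'⊆Aℓ+1)
      where
      v-active : active (suc ℓ) v ≡ true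
      v-active = threshold-active ℓ v (≤-trans
        (m∸n≡0⇒m≤n (trans (sym (k≡t∸degIn-Uᶜ I v (∈⇒lookup v∈U))) kv≡0))
        (degIn-mono v λ w w∉U → Uᶜ⊆Aℓ w (not-true w∉U)))
        where
        not-true : ∀ {b} → not b ≡ true → b ≡ false
        not-true {false} _ = refl
      Uᶜ'⊆Aℓ+1 : ∀ w → lookup (U s - v) w ≡ false → active (suc ℓ) w ≡ true
      Uᶜ'⊆Aℓ+1 w w∉U' with ∉U-v⇒ s v w w∉U'
      ... | inj₁ w∉U = active-suc ℓ w (Uᶜ⊆Aℓ w w∉U)
      ... | inj₂ refl = v-active
    run-isTargetSet {s} (step st@(case2 _ v _ _ _) run) I (ℓ , Uᶜ⊆Aℓ) =
      run-isTargetSet run (invariant-step st I) (ℓ , Uᶜ'⊆Aℓ)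
      where
      Uᶜ'⊆Aℓ : ∀ w → lookup (U s - v) w ≡ false → active ℓ w ≡ true
      Uᶜ'⊆Aℓ w w∉U' with ∉U-v⇒ s v w w∉U'
      ... | inj₁ w∉U = Uᶜ⊆Aℓ w w∉U
      ... | inj₂ refl = seed-active v (S⊆result run v (lookup-∪⁅⁆ (S s) v)) ℓ
    run-isTargetSet (step st@(case3 _ _ _ _ _ _) run) I Uᶜ⊆A = run-isTargetSet run (invariant-step st I) Uᶜ⊆A

  MTS-isTargetSet : ∀ t R → MTSReturns G t R → IsTargetSet G t R
  MTS-isTargetSet t R run =
    run-isTargetSet t R run (invariant-init t) (0 , λ v v∉V → ⊥-elim (true≢false (trans (sym (lookup-⊤ v)) v∉V)))

  small-targetSet-is-everything : ∀ t R → (∀ v → ∣ R ∣ < t v) → IsTargetSet G t R → ∣ R ∣ ≡ n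
  small-targetSet-is-everything t R R<t (ℓ , all-active) =
    trans (∣p∣≡count R) (count-all (λ v →
      active⊆seeds t R (λ w → subst (_< t w) (∣p∣≡count R) (R<t w)) ℓ v (∈⇒lookup (all-active v))))

  2⊓n≤∣targetSet∣ : ∀ R → IsTargetSet G (λ _ → 2) R → 2 ⊓ n ≤ ∣ R ∣
  2⊓n≤∣targetSet∣ R target with 2 ≤? ∣ R ∣
  ... | yes 2≤∣R∣ = ≤-trans (m⊓n≤m 2 n) 2≤∣R∣
  ... | no 2≰∣R∣ =
    ≤-trans (m⊓n≤n 2 n) (≤-reflexive (sym (small-targetSet-is-everything (λ _ → 2) R (λ _ → ≰⇒> 2≰∣R∣) target)))

  -- The Caro–Wei potential

  K : ℕ
  K = n !

  weight : ℕ → ℕ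
  weight d = 2 * (K / suc d)

  -- Φ X = Σ_{u ∈ X} 2 / (deg_X u + 1), scaled by K = n! so that every division is exact.
  Φ-term : (Fin n → Bool) → Fin n → ℕ
  Φ-term X u = if X u then weight (degIn u X) else 0

  Φ : (Fin n → Bool) → ℕ
  Φ X = sum (Φ-term X)

  Φ-cong : ∀ {X Y : Fin n → Bool} → (∀ w → X w ≡ Y w) → Φ X ≡ Φ Y
  Φ-cong {X} {Y} X≗Y = sum-cong-≗ Φ-term≗
    where
    Φ-term≗ : ∀ u → Φ-term X u ≡ Φ-term Y u
    Φ-term≗ u rewrite X≗Y u | degIn-cong u X≗Y = refl

  weight-gain≤ : ∀ d δ → d ≤ δ → suc δ < n →
    weight δ ≤ weight (suc δ) + 2 * (K / (suc d * suc (suc d)))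
  weight-gain≤ d δ d≤δ δ+1<n = /-gain≤ K d δ d≤δ (suc*suc∣! δ n δ+1<n)

  -- Removing x of degree d = d' + 1 loses 2/(d+1) at x, while each of its d neighbours,
  -- of degree at least d, gains at most 2/(d(d+1)).
  module RemoveMinDegree (X : Fin n → Bool) {x} (x∈X : X x ≡ true) {d'} (deg-x : degIn x X ≡ suc d')
    (min-deg : ∀ u → X u ≡ true → suc d' ≤ degIn u X) where

    gain : ℕ
    gain = 2 * (K / (suc d' * suc (suc d')))

    Φ-term-remove≤ : ∀ u → Φ-term (X ∖ x) u + bit (x == u) * weight (suc d') ≤ Φ-term X u + bit (X u ∧ adj G x u) * gain
    Φ-term-remove≤ u with x == u in x=u
    ... | true rewrite sym (==⇒≡ x=u) | ∧-zeroʳ (X x) | x∈X | loopless G x | deg-x = ≤-refl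
    ... | false with X u in u∈X
    ... | false = z≤n
    ... | true with adj G x u in x~u | degIn-∖ u X x
    ... | false | deg-u = ≤-reflexive (cong (λ d → weight d + 0) (sym deg-u))
    ... | true | deg-u rewrite x∈X = begin
        weight (degIn u (X ∖ x)) + 0
      ≡⟨ +-identityʳ _ ⟩
        weight (degIn u (X ∖ x))
      ≤⟨ weight-gain≤ d' (degIn u (X ∖ x)) (≤-pred (≤-trans (min-deg u u∈X) (≤-reflexive deg-u)))
           (subst (_< n) deg-u (degIn<n u X)) ⟩
        weight (suc (degIn u (X ∖ x))) + gain
      ≡⟨ cong (λ d → weight d + gain) (sym deg-u) ⟩
        weight (degIn u X) + gain
      ≡⟨ cong (weight (degIn u X) +_) (sym (+-identityʳ gain)) ⟩
        weight (degIn u X) + 1 * gain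
      ∎
      where open ≤-Reasoning

    [d'+1]*gain≡weight : suc d' * gain ≡ weight (suc d')
    [d'+1]*gain≡weight = trans (x*[2*y]≡2*[x*y] (suc d') (K / (suc d' * suc (suc d'))))
      (cong (2 *_) (suc*/suc*suc K d' (suc*suc∣! d' n (subst (_< n) deg-x (degIn<n x X)))))
      where
      x*[2*y]≡2*[x*y] : ∀ x y → x * (2 * y) ≡ 2 * (x * y)
      x*[2*y]≡2*[x*y] = solve-∀

    Φ-remove≤ : Φ (X ∖ x) ≤ Φ X
    Φ-remove≤ = +-cancelʳ-≤ (weight (suc d')) _ _ (begin
        Φ (X ∖ x) + weight (suc d')
      ≡⟨ cong (Φ (X ∖ x) +_) (sym (trans (count-*ʳ (x ==_) (weight (suc d')))
           (trans (cong (_* weight (suc d')) (count-single x)) (+-identityʳ _)))) ⟩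
        Φ (X ∖ x) + sum (λ u → bit (x == u) * weight (suc d'))
      ≡⟨ sym (∑-distrib-+ (Φ-term (X ∖ x)) _) ⟩
        sum (λ u → Φ-term (X ∖ x) u + bit (x == u) * weight (suc d'))
      ≤⟨ sum-mono Φ-term-remove≤ ⟩
        sum (λ u → Φ-term X u + bit (X u ∧ adj G x u) * gain)
      ≡⟨ ∑-distrib-+ (Φ-term X) _ ⟩
        Φ X + sum (λ u → bit (X u ∧ adj G x u) * gain)
      ≡⟨ cong (Φ X +_) (trans (count-*ʳ (λ u → X u ∧ adj G x u) gain) (cong (_* gain) (trans (count-adj X x) deg-x))) ⟩
        Φ X + suc d' * gain
      ≡⟨ cong (Φ X +_) [d'+1]*gain≡weight ⟩
        Φ X + weight (suc d')
      ∎)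
      where open ≤-Reasoning

  Φ-remove-minDegree : ∀ X x → X x ≡ true → 1 ≤ degIn x X →
    (∀ u → X u ≡ true → degIn x X ≤ degIn u X) → Φ (X ∖ x) ≤ Φ X
  Φ-remove-minDegree X x x∈X 1≤d min-deg with degIn x X in deg-x | 1≤d
  ... | suc d' | _ = RemoveMinDegree.Φ-remove≤ X x∈X deg-x min-deg

  weight*[n+2]≤4K : Dirac G → ∀ u → weight (degIn u (λ _ → true)) * (n + 2) ≤ 4 * K
  weight*[n+2]≤4K dirac u = begin
      2 * q * (n + 2)
    ≤⟨ *-monoʳ-≤ (2 * q) n+2≤2[D+1] ⟩
      2 * q * (2 * suc D)
    ≡⟨ regroup q (suc D) ⟩
      4 * (q * suc D)
    ≡⟨ cong (4 *_) (m/n*n≡m (suc∣! D n (degIn<n u (λ _ → true)))) ⟩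
      4 * K
    ∎
    where
    open ≤-Reasoning
    D = degIn u (λ _ → true)
    q = K / suc D
    regroup : ∀ q d → 2 * q * (2 * d) ≡ 4 * (q * d)
    regroup = solve-∀
    n+2≤2[D+1] : n + 2 ≤ 2 * suc D
    n+2≤2[D+1] = ≤-trans (+-monoˡ-≤ 2 (≤-trans (dirac u) (≤-reflexive (cong (2 *_) (deg≡degIn-all u)))))
      (≤-reflexive (trans (+-comm (2 * D) 2) (sym (*-suc 2 D))))

  Φ-Dirac<4K : Dirac G → Φ (λ _ → true) < 4 * K
  Φ-Dirac<4K dirac = *-cancelʳ-< (n + 2) (Φ (λ _ → true)) (4 * K) (begin-strict
      Φ (λ _ → true) * (n + 2)
    ≡⟨ sym (sum-*ʳ (λ u → weight (degIn u (λ _ → true))) (n + 2)) ⟩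
      sum (λ u → weight (degIn u (λ _ → true)) * (n + 2))
    ≤⟨ sum-mono (weight*[n+2]≤4K dirac) ⟩
      sum {n} (λ _ → 4 * K)
    ≡⟨ trans (sum-const {n} (4 * K)) (*-comm n (4 * K)) ⟩
      4 * K * n
    <⟨ *-monoʳ-< (4 * K) (m<m+n n {2} (s≤s z≤n)) ⟩
      4 * K * (n + 2)
    ∎)
    where
    open ≤-Reasoning
    instance
      4K≢0 : NonZero (4 * K)
      4K≢0 = >-nonZero (≤-trans (1≤n! n) (m≤n*m K 4))

  K≤weight : 2 ≤ n → ∀ x → x ≤ 1 → K ≤ weight x
  K≤weight 2≤n x x≤1 = begin
      K
    ≡⟨ sym (trans (*-comm 2 (K / 2)) (m/n*n≡m (suc∣! 1 n 2≤n))) ⟩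
      2 * (K / 2)
    ≤⟨ *-monoʳ-≤ 2 (/-monoʳ-≤ K (s≤s x≤1)) ⟩
      weight x
    ∎
    where open ≤-Reasoning

  -- Two leaves v₁, v₂ of W adjacent only to each other contribute K each, and the rest Y of W,
  -- each of whose vertices has all its neighbours inside Y, contributes at least 2K.
  module TwoLeaves (W : Fin n → Bool) {v₁ v₂ v₃}
    (v₁≢v₂ : ¬ v₁ ≡ v₂) (v₃≢v₁ : ¬ v₃ ≡ v₁) (v₃≢v₂ : ¬ v₃ ≡ v₂)
    (v₁∈W : W v₁ ≡ true) (v₂∈W : W v₂ ≡ true) (v₃∈W : W v₃ ≡ true)
    (deg-v₁≤1 : degIn v₁ W ≤ 1) (deg-v₂≤1 : degIn v₂ W ≤ 1)
    (isolated : ∀ y → W y ≡ true → ¬ y ≡ v₁ → ¬ y ≡ v₂ → (adj G v₁ y ≡ false) × (adj G v₂ y ≡ false)) where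

    Y : Fin n → Bool
    Y = (W ∖ v₁) ∖ v₂

    c : ℕ
    c = count Y ∸ 1

    ∣Y∣≡1+c : count Y ≡ suc c
    ∣Y∣≡1+c = sym (m+[n∸m]≡n (count≥1 Y (∈∖ {X = W ∖ v₁} (∈∖ {X = W} v₃∈W v₃≢v₁) v₃≢v₂)))

    [1+c]*[K/[1+c]]≡K : suc c * (K / suc c) ≡ K
    [1+c]*[K/[1+c]]≡K = trans (*-comm (suc c) _) (m/n*n≡m (suc∣! c n (≤-trans (≤-reflexive (sym ∣Y∣≡1+c)) (count≤n Y))))

    deg-Y<∣Y∣ : ∀ y → Y y ≡ true → suc (degIn y W) ≤ suc c
    deg-Y<∣Y∣ y y∈Y = ≤-trans (count-<-pick y nbrs⊆Y y∈Y (cong (_∧ W y) (loopless G y))) (≤-reflexive ∣Y∣≡1+c)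
      where
      y∈W∖v₁ : (W ∖ v₁) y ≡ true
      y∈W∖v₁ = ∖⇒∈ {X = W ∖ v₁} y∈Y
      isolated-y = isolated y (∖⇒∈ {X = W} y∈W∖v₁) (∖⇒≢ {X = W} y∈W∖v₁) (∖⇒≢ {X = W ∖ v₁} y∈Y)
      nbrs⊆Y : ∀ w → (adj G w y ∧ W w) ≡ true → Y w ≡ true
      nbrs⊆Y w w∈nbrs = ∈∖ {X = W ∖ v₁} (∈∖ {X = W} (∧-conicalʳ _ _ w∈nbrs) w≢v₁) w≢v₂
        where
        w~y : adj G w y ≡ true
        w~y = ∧-conicalˡ _ _ w∈nbrs
        w≢v₁ : ¬ w ≡ v₁
        w≢v₁ refl = true≢false (trans (sym w~y) (proj₁ isolated-y))
        w≢v₂ : ¬ w ≡ v₂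
        w≢v₂ refl = true≢false (trans (sym w~y) (proj₂ isolated-y))

    share : Fin n → ℕ
    share u = bit (v₁ == u) * K + bit (v₂ == u) * K + bit (Y u) * (2 * (K / suc c))

    Σshare≡4K : sum share ≡ 4 * K
    Σshare≡4K = begin
        sum share
      ≡⟨ trans (∑-distrib-+ (λ u → bit (v₁ == u) * K + bit (v₂ == u) * K) _)
               (cong₂ _+_ (∑-distrib-+ (λ u → bit (v₁ == u) * K) _) (count-*ʳ Y (2 * q))) ⟩
        sum (λ u → bit (v₁ == u) * K) + sum (λ u → bit (v₂ == u) * K) + count Y * (2 * q)
      ≡⟨ cong₂ (λ a b → a + b + count Y * (2 * q))
               (trans (count-*ʳ (v₁ ==_) K) (cong (_* K) (count-single v₁)))
               (trans (count-*ʳ (v₂ ==_) K) (cong (_* K) (count-single v₂))) ⟩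
        1 * K + 1 * K + count Y * (2 * q)
      ≡⟨ cong (λ c → 1 * K + 1 * K + c * (2 * q)) ∣Y∣≡1+c ⟩
        1 * K + 1 * K + suc c * (2 * q)
      ≡⟨ regroup K (suc c) q ⟩
        2 * K + 2 * (suc c * q)
      ≡⟨ cong (λ z → 2 * K + 2 * z) [1+c]*[K/[1+c]]≡K ⟩
        2 * K + 2 * K
      ≡⟨ 2k+2k≡4k K ⟩
        4 * K
      ∎
      where
      open ≡-Reasoning
      q = K / suc c
      regroup : ∀ k c q → 1 * k + 1 * k + c * (2 * q) ≡ 2 * k + 2 * (c * q)
      regroup = solve-∀
      2k+2k≡4k : ∀ k → 2 * k + 2 * k ≡ 4 * k
      2k+2k≡4k = solve-∀

    2≤n : 2 ≤ n
    2≤n = ≤-trans (count≥2 (λ _ → true) refl refl v₁≢v₂) (count≤n (λ _ → true))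

    1k+0k+0x≡k : ∀ k x → 1 * k + 0 * k + 0 * x ≡ k
    1k+0k+0x≡k = solve-∀

    0k+1k+0x≡k : ∀ k x → 0 * k + 1 * k + 0 * x ≡ k
    0k+1k+0x≡k = solve-∀

    share≤Φ-term : ∀ u → share u ≤ Φ-term W u
    share≤Φ-term u with v₁ == u in v₁=u
    ... | true rewrite sym (==⇒≡ v₁=u) | v₁∈W | ≢⇒==false (λ e → v₁≢v₂ (sym e)) =
      ≤-trans (≤-reflexive (1k+0k+0x≡k K (2 * (K / suc c)))) (K≤weight 2≤n _ deg-v₁≤1)
    ... | false with v₂ == u in v₂=u
    ... | true rewrite sym (==⇒≡ v₂=u) | v₂∈W =
      ≤-trans (≤-reflexive (0k+1k+0x≡k K (2 * (K / suc c)))) (K≤weight 2≤n _ deg-v₂≤1)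
    ... | false with W u in u∈W
    ... | false = z≤n
    ... | true = ≤-trans (≤-reflexive (+-identityʳ (2 * (K / suc c)))) (*-monoʳ-≤ 2 (/-monoʳ-≤ K (deg-Y<∣Y∣ u u∈Y)))
      where
      u∈Y : Y u ≡ true
      u∈Y rewrite u∈W | v₁=u | v₂=u = refl

    4K≤Φ : 4 * K ≤ Φ W
    4K≤Φ = ≤-trans (≤-reflexive (sym Σshare≡4K)) (sum-mono share≤Φ-term)

  -- Thin cuts of Dirac graphs

  -- D plays the set of removed nodes when a third seed is about to be chosen: every node outside D
  -- has at most one neighbour in D. With n = 2m + r, Dirac's condition gives each d ∈ D at least
  -- (r + 2)/2 neighbours outside D, so double counting the cut yields m (r + 2) ≤ 2 (m + r), and the
  -- slack r (m - 2) ≥ 0 of this inequality must vanish.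
  module ThinCut (dirac : Dirac G) (D : Fin n → Bool)
    (thin : ∀ u → D u ≡ false → degIn u D ≤ 1)
    {v₁ v₂ u₀ : Fin n} (v₁≢v₂ : ¬ v₁ ≡ v₂)
    (v₁∈D : D v₁ ≡ true) (v₂∈D : D v₂ ≡ true) (u₀∉D : D u₀ ≡ false)
    where

    Dᶜ : Fin n → Bool
    Dᶜ = not ∘ D

    m r : ℕ
    m = count D
    r = n ∸ 2 * m

    dirac-split : ∀ u → n ≤ 2 * (degIn u Dᶜ + degIn u D)
    dirac-split u = ≤-trans (dirac u) (≤-reflexive (cong (2 *_) (begin
        deg G u
      ≡⟨ deg≡degIn-all u ⟩
        count (λ w → adj G w u ∧ true)
      ≡⟨ count-cong (λ w → ∧-identityʳ (adj G w u)) ⟩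
        count (λ w → adj G w u)
      ≡⟨ count-split (λ w → adj G w u) D ⟩
        degIn u D + degIn u Dᶜ
      ≡⟨ +-comm (degIn u D) _ ⟩
        degIn u Dᶜ + degIn u D
      ∎)))
      where open ≡-Reasoning

    2m+r≡n : 2 * m + r ≡ n
    2m+r≡n = m+[n∸m]≡n (u+m≡n⇒2m≤n n m (count Dᶜ) (degIn u₀ Dᶜ) (degIn u₀ D) (dirac-split u₀)
      (degIn<count Dᶜ u₀ (cong not u₀∉D)) (thin u₀ u₀∉D) (trans (+-comm (count Dᶜ) m) (count-compl D)))

    ∣Dᶜ∣≡m+r : count Dᶜ ≡ m + r
    ∣Dᶜ∣≡m+r = +-cancelˡ-≡ m (count Dᶜ) (m + r) (begin
        m + count Dᶜ
      ≡⟨ count-compl D ⟩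
        n
      ≡⟨ sym 2m+r≡n ⟩
        2 * m + r
      ≡⟨ cong (_+ r) (cong (m +_) (+-identityʳ m)) ⟩
        m + m + r
      ≡⟨ +-assoc m m r ⟩
        m + (m + r)
      ∎)
      where open ≡-Reasoning

    r+2c≤2degIn-Dᶜ : ∀ d c → c + degIn d D ≤ m → r + 2 * c ≤ 2 * degIn d Dᶜ
    r+2c≤2degIn-Dᶜ d c c+deg≤m =
      2m+r≤2[x+y]⇒r+2c≤2x m r (degIn d Dᶜ) (degIn d D) c (≤-trans (≤-reflexive 2m+r≡n) (dirac-split d)) c+deg≤m

    cut : Fin n → Fin n → Bool
    cut d w = D d ∧ (adj G w d ∧ Dᶜ w)

    cut-rows≡cut-columns : sum (λ d → count (cut d)) ≡ sum (λ w → count (λ d → cut d w))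
    cut-rows≡cut-columns = ∑-comm (λ d w → bit (cut d w))

    column≤degIn : ∀ w → count (λ d → cut d w) ≤ degIn w D
    column≤degIn w = count-mono λ d d∈cut →
      ∧-true (trans (adj-sym G d w) (∧-conicalˡ _ _ (∧-conicalʳ (D d) _ d∈cut))) (∧-conicalˡ (D d) _ d∈cut)

    column≤1 : ∀ w → count (λ d → cut d w) ≤ bit (Dᶜ w)
    column≤1 w = by-membership (D w) refl
      where
      by-membership : ∀ b → D w ≡ b → count (λ d → cut d w) ≤ bit (not b)
      by-membership true w∈D = ≤-reflexive (count-none λ d →
        trans (cong (λ b → D d ∧ (adj G w d ∧ not b)) w∈D) (x∧[y∧false] (D d) (adj G w d)))
        where
        x∧[y∧false] : ∀ x y → (x ∧ (y ∧ false)) ≡ false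
        x∧[y∧false] true y = ∧-zeroʳ y
        x∧[y∧false] false y = refl
      by-membership false w∉D = ≤-trans (column≤degIn w) (thin w w∉D)

    row≡degIn-Dᶜ : ∀ d → D d ≡ true → count (cut d) ≡ degIn d Dᶜ
    row≡degIn-Dᶜ d d∈D = count-cong (λ w → cong (_∧ (adj G w d ∧ Dᶜ w)) d∈D)

    row≥ : ∀ d → bit (D d) * (r + 2) ≤ 2 * count (cut d)
    row≥ d = by-membership (D d) refl
      where
      by-membership : ∀ b → D d ≡ b → bit b * (r + 2) ≤ 2 * count (cut d)
      by-membership false _ = z≤n
      by-membership true d∈D = ≤-trans (≤-reflexive (+-identityʳ (r + 2)))
        (≤-trans (r+2c≤2degIn-Dᶜ d 1 (degIn<count D d d∈D)) (≤-reflexive (cong (2 *_) (sym (row≡degIn-Dᶜ d d∈D)))))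

    2·rows≡2·cut : sum (λ d → 2 * count (cut d)) ≡ 2 * sum (λ w → count (λ d → cut d w))
    2·rows≡2·cut = trans (sum-*ˡ 2 (λ d → count (cut d))) (cong (2 *_) cut-rows≡cut-columns)

    cut≤∣Dᶜ∣ : sum (λ w → count (λ d → cut d w)) ≤ m + r
    cut≤∣Dᶜ∣ = ≤-trans (sum-mono column≤1) (≤-reflexive ∣Dᶜ∣≡m+r)

    m[r+2]≡Σrow : m * (r + 2) ≡ sum (λ d → bit (D d) * (r + 2))
    m[r+2]≡Σrow = sym (count-*ʳ D (r + 2))

    m[r+2]≤2[m+r] : m * (r + 2) ≤ 2 * (m + r)
    m[r+2]≤2[m+r] = begin
        m * (r + 2)
      ≡⟨ m[r+2]≡Σrow ⟩
        sum (λ d → bit (D d) * (r + 2))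
      ≤⟨ sum-mono row≥ ⟩
        sum (λ d → 2 * count (cut d))
      ≡⟨ 2·rows≡2·cut ⟩
        2 * sum (λ w → count (λ d → cut d w))
      ≤⟨ *-monoʳ-≤ 2 cut≤∣Dᶜ∣ ⟩
        2 * (m + r)
      ∎
      where open ≤-Reasoning

    2≤m : 2 ≤ m
    2≤m = count≥2 D v₁∈D v₂∈D v₁≢v₂

    D-outdegree-bound : ∀ d → D d ≡ true → ¬ (r + 4 ≤ 2 * degIn d Dᶜ)
    D-outdegree-bound d d∈D r+4≤ = m[r+2]+2≰2[m+r] m r 2≤m (begin
        m * (r + 2) + 2
      ≡⟨ cong (_+ 2) m[r+2]≡Σrow ⟩
        sum (λ d → bit (D d) * (r + 2)) + 2
      ≤⟨ sum-<-pick d 2 row≥ row-d ⟩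
        sum (λ d → 2 * count (cut d))
      ≡⟨ 2·rows≡2·cut ⟩
        2 * sum (λ w → count (λ d → cut d w))
      ≤⟨ *-monoʳ-≤ 2 cut≤∣Dᶜ∣ ⟩
        2 * (m + r)
      ∎)
      where
      open ≤-Reasoning
      row-d : bit (D d) * (r + 2) + 2 ≤ 2 * count (cut d)
      row-d = begin
          bit (D d) * (r + 2) + 2
        ≡⟨ cong (λ b → bit b * (r + 2) + 2) d∈D ⟩
          (r + 2 + 0) + 2
        ≡⟨ trans (cong (_+ 2) (+-identityʳ (r + 2))) (+-assoc r 2 2) ⟩
          r + 4
        ≤⟨ r+4≤ ⟩
          2 * degIn d Dᶜ
        ≡⟨ cong (2 *_) (sym (row≡degIn-Dᶜ d d∈D)) ⟩
          2 * count (cut d)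
        ∎

    Dᶜ-covered : ∀ u → D u ≡ false → 1 ≤ degIn u D
    Dᶜ-covered u u∉D with degIn u D in deg≡0 | column≤degIn u
    ... | suc _ | _ = s≤s z≤n
    ... | zero | col≤0 = ⊥-elim (m[r+2]+2≰2[m+r] m r 2≤m (begin
        m * (r + 2) + 2
      ≤⟨ +-monoˡ-≤ 2 (≤-trans (≤-reflexive m[r+2]≡Σrow) (≤-trans (sum-mono row≥) (≤-reflexive 2·rows≡2·cut))) ⟩
        2 * sum (λ w → count (λ d → cut d w)) + 2
      ≡⟨ sym (*-distribˡ-+ 2 (sum (λ w → count (λ d → cut d w))) 1) ⟩
        2 * (sum (λ w → count (λ d → cut d w)) + 1)
      ≤⟨ *-monoʳ-≤ 2 (≤-trans (sum-<-pick u 1 column≤1 col-u) (≤-reflexive ∣Dᶜ∣≡m+r)) ⟩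
        2 * (m + r)
      ∎))
      where
      open ≤-Reasoning
      col-u : count (λ d → cut d u) + 1 ≤ bit (Dᶜ u)
      col-u rewrite n≤0⇒n≡0 col≤0 | u∉D = ≤-refl

    D-clique : ∀ d d' → D d ≡ true → D d' ≡ true → ¬ d ≡ d' → adj G d' d ≡ true
    D-clique d d' d∈D d'∈D d≢d' with adj G d' d in d'~d
    ... | true = refl
    ... | false = ⊥-elim (D-outdegree-bound d d∈D (r+2c≤2degIn-Dᶜ d 2
        (count-<-pick₂ d d' (λ w → ∧-conicalʳ (adj G w d) (D w)) d∈D d'∈D d≢d'
          (cong (_∧ D d) (loopless G d)) (cong (_∧ D d') d'~d))))

    r≡0 : 3 ≤ m → r ≡ 0
    r≡0 3≤m = m[r+2]≤2[m+r]⇒r≡0 m r 3≤m m[r+2]≤2[m+r]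

    D-outdegree≤1 : 3 ≤ m → ∀ d → D d ≡ true → degIn d Dᶜ ≤ 1
    D-outdegree≤1 3≤m d d∈D with 2 ≤? degIn d Dᶜ
    ... | no deg≱2 = ≤-pred (≰⇒> deg≱2)
    ... | yes 2≤deg =
      ⊥-elim (D-outdegree-bound d d∈D (≤-trans (≤-reflexive (cong (_+ 4) (r≡0 3≤m))) (*-monoʳ-≤ 2 2≤deg)))


  -- At most two seeds on a Dirac graph

  record FirstSeed : Set where
    field
      v₁ : Fin n
      W₁ : Fin n → Bool
      v₁∈W₁ : W₁ v₁ ≡ true
      deg-v₁≤1 : degIn v₁ W₁ ≤ 1
      Φ<4K : Φ W₁ < 4 * K

  module _ (σ : FirstSeed) where
    open FirstSeed σ

    -- The values of δ and k right after v₁ has been added to S.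
    δ₁ k₁ : Fin n → ℕ
    δ₁ u = degIn u (W₁ ∖ v₁)
    k₁ u = 2 ∸ degIn u (v₁ ==_)

    k₁≥1 : ∀ u → 1 ≤ k₁ u
    k₁≥1 u = 1≤2∸ _ (degIn-single≤1 u v₁)

    k₁≤1 : ∀ u → adj G v₁ u ≡ true → k₁ u ≤ 1
    k₁≤1 u v₁~u = 2∸≤1 _ (degIn≥1 u v₁~u (==-refl v₁))

    Case3Choice : Fin n → Set
    Case3Choice z = (W₁ ∖ v₁) z ≡ true × ¬ (δ₁ z < k₁ z) ×
      (∀ u → (W₁ ∖ v₁) u ≡ true → k₁ u * (δ₁ z * suc (δ₁ z)) ≤ k₁ z * (δ₁ u * suc (δ₁ u)))

  data AfterFirstSeed (σ : FirstSeed) (s : State n) : Set where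
    no-case3-yet : (∀ i → U∖L s i ≡ (FirstSeed.W₁ σ ∖ FirstSeed.v₁ σ) i) → AfterFirstSeed σ s
    first-case3 : (z : Fin n) → inL s z ≡ true → Case3Choice σ z → AfterFirstSeed σ s

  record TwoSeeds (s : State n) : Set where
    field
      σ : FirstSeed
      v₂ : Fin n
    open FirstSeed σ
    field
      S≡v₁,v₂ : ∀ i → inS s i ≡ ((v₁ == i) ∨ (v₂ == i))
      v₁≢v₂ : ¬ v₁ ≡ v₂
      v₁∉U : inU s v₁ ≡ false
      v₂∉U : inU s v₂ ≡ false
      v₂∈W₁ : W₁ v₂ ≡ true
      U∖L⊆W₁ : ∀ i → U∖L s i ≡ true → W₁ i ≡ true
      v₂-isolated : adj G v₁ v₂ ≡ true → ∀ i → U∖L s i ≡ true → adj G i v₂ ≡ false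
      v₂-choice : δ₁ σ v₂ < k₁ σ v₂ ⊎ ∃ λ z → Case3Choice σ z × ¬ z ≡ v₂

  data Phase (s : State n) : Set where
    no-seed : (∀ i → inS s i ≡ false) → (∀ i → inU s i ≡ true) → Φ (U∖L s) < 4 * K → Phase s
    one-seed : (σ : FirstSeed) → (∀ i → inS s i ≡ (FirstSeed.v₁ σ == i)) →
      (∀ i → inU s i ≡ not (FirstSeed.v₁ σ == i)) → (∀ i → U∖L s i ≡ true → FirstSeed.W₁ σ i ≡ true) →
      AfterFirstSeed σ s → Phase s
    two-seeds : TwoSeeds s → Phase s

  ∣S∣≤2 : ∀ {s} → Phase s → count (inS s) ≤ 2
  ∣S∣≤2 (no-seed S≡∅ _ _) = ≤-trans (≤-reflexive (count-none S≡∅)) z≤n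
  ∣S∣≤2 (one-seed σ S≡v₁ _ _ _) =
    ≤-trans (≤-reflexive (trans (count-cong S≡v₁) (count-single (FirstSeed.v₁ σ)))) (s≤s z≤n)
  ∣S∣≤2 (two-seeds ts) = ≤-trans (≤-reflexive (count-cong S≡v₁,v₂))
    (≤-trans (count-∨ (v₁ ==_) (v₂ ==_)) (≤-reflexive (cong₂ _+_ (count-single v₁) (count-single v₂))))
    where
    open TwoSeeds ts
    open FirstSeed σ

  module NoSeed {s : State n} (I : Invariant (λ _ → 2) s) (S≡∅ : ∀ i → inS s i ≡ false)
    (U≡V : ∀ i → inU s i ≡ true) (Φ<4K : Φ (U∖L s) < 4 * K) where

    k≡2 : ∀ u → k s u ≡ 2
    k≡2 u = trans (k≡t∸degIn-Uᶜ I u (U≡V u)) (cong (2 ∸_) (degIn-none u (λ w → cong not (U≡V w))))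

    δ≡degIn : ∀ u → δ s u ≡ degIn u (U∖L s)
    δ≡degIn u = δ≡degIn-U∖L I u (U≡V u)

    first-seed : ∀ {v} → v ∈ U s → v ∉ L s → δ s v < k s v → FirstSeed
    first-seed {v} v∈U v∉L δ<k = record
      { v₁ = v ; W₁ = U∖L s ; v₁∈W₁ = ∈U∖L s v∈U v∉L
      ; deg-v₁≤1 = ≤-pred (subst₂ _<_ (δ≡degIn v) (k≡2 v) δ<k)
      ; Φ<4K = Φ<4K
      }

    -- With all k equal to 2, Case 3 selects a node of minimum degree in U ∖ L.
    case3-Φ<4K : ∀ {x} → (∀ u → u ∈ U s → u ∉ L s → ¬ δ s u < k s u) → x ∈ U s → x ∉ L s →
      (∀ u → u ∈ U s → u ∉ L s → k s u * (δ s x * suc (δ s x)) ≤ k s x * (δ s u * suc (δ s u))) →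
      Φ (U∖L s ∖ x) < 4 * K
    case3-Φ<4K {x} no-case2 x∈U x∉L ratio-max =
      ≤-<-trans (Φ-remove-minDegree (U∖L s) x (∈U∖L s x∈U x∉L) (≤-trans (s≤s z≤n) 2≤deg-x) min-deg) Φ<4K
      where
      2≤deg-x : 2 ≤ degIn x (U∖L s)
      2≤deg-x = subst₂ _≤_ (k≡2 x) (δ≡degIn x) (≮⇒≥ (no-case2 x x∈U x∉L))
      min-deg : ∀ u → U∖L s u ≡ true → degIn x (U∖L s) ≤ degIn u (U∖L s)
      min-deg u u∈ = m[1+m]≤n[1+n]⇒m≤n _ _ (*-cancelˡ-≤ 2 (subst₂ _≤_
        (cong₂ (λ a b → a * (b * suc b)) (k≡2 u) (δ≡degIn x)) (cong₂ (λ a b → a * (b * suc b)) (k≡2 x) (δ≡degIn u))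
        (ratio-max u (U∖L⇒∈U s u∈) (U∖L⇒∉L s u∈))))

    transition : ∀ {s'} → Step G s s' → Phase s'
    transition (case1 v _ kv≡0) = ⊥-elim (0≢1+n (trans (sym kv≡0) (k≡2 v)))
    transition st@(case2 _ v v∈U v∉L δ<k) = one-seed (first-seed v∈U v∉L δ<k)
      (λ i → trans (lookup-∪ (S s) ⁅ v ⁆ i) (cong₂ _∨_ (S≡∅ i) (lookup-⁅⁆ v i)))
      (λ i → trans (lookup-- (U s) v i) (cong (_∧ not (v == i)) (U≡V i)))
      (U∖L-shrinks st)
      (no-case3-yet (U∖L-removeU s v))
    transition (case3 _ no-case2 x x∈U x∉L ratio-max) =
      no-seed S≡∅ U≡V (≤-<-trans (≤-reflexive (Φ-cong (U∖L-addL s x))) (case3-Φ<4K no-case2 x∈U x∉L ratio-max))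

  module OneSeed (σ : FirstSeed) {s : State n} (I : Invariant (λ _ → 2) s)
    (S≡v₁ : ∀ i → inS s i ≡ (FirstSeed.v₁ σ == i)) (U≡V-v₁ : ∀ i → inU s i ≡ not (FirstSeed.v₁ σ == i))
    (U∖L⊆W₁ : ∀ i → U∖L s i ≡ true → FirstSeed.W₁ σ i ≡ true) where
    open FirstSeed σ

    k≡k₁ : ∀ u → inU s u ≡ true → k s u ≡ k₁ σ u
    k≡k₁ u u∈U = trans (k≡t∸degIn-Uᶜ I u u∈U)
      (cong (2 ∸_) (degIn-cong u (λ w → trans (cong not (U≡V-v₁ w)) (not-involutive (v₁ == w)))))

    k≥1 : ∀ u → inU s u ≡ true → 1 ≤ k s u
    k≥1 u u∈U = subst (1 ≤_) (sym (k≡k₁ u u∈U)) (k₁≥1 σ u)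

    module _ (U∖L≗ : ∀ i → U∖L s i ≡ (W₁ ∖ v₁) i) where

      δ≡δ₁ : ∀ u → inU s u ≡ true → δ s u ≡ δ₁ σ u
      δ≡δ₁ u u∈U = trans (δ≡degIn-U∖L I u u∈U) (degIn-cong u U∖L≗)

      case3-choice : ∀ {x} → (∀ u → u ∈ U s → u ∉ L s → ¬ δ s u < k s u) → x ∈ U s → x ∉ L s →
        (∀ u → u ∈ U s → u ∉ L s → k s u * (δ s x * suc (δ s x)) ≤ k s x * (δ s u * suc (δ s u))) →
        Case3Choice σ x
      case3-choice {x} no-case2 x∈U x∉L ratio-max =
          trans (sym (U∖L≗ x)) (∈U∖L s x∈U x∉L)
        , (λ δ₁<k₁ → no-case2 x x∈U x∉L (subst₂ _<_ (sym (δ≡δ₁ x x∈U')) (sym (k≡k₁ x x∈U')) δ₁<k₁))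
        , λ u u∈ → let u∈U∖L = trans (U∖L≗ u) u∈
                       u∈U = ∧-conicalˡ (inU s u) _ u∈U∖L in
          subst₂ _≤_ (cong₂ (λ a b → a * (b * suc b)) (k≡k₁ u u∈U) (δ≡δ₁ x x∈U'))
                     (cong₂ (λ a b → a * (b * suc b)) (k≡k₁ x x∈U') (δ≡δ₁ u u∈U))
            (ratio-max u (U∖L⇒∈U s u∈U∖L) (U∖L⇒∉L s u∈U∖L))
        where
        x∈U' = ∈⇒lookup x∈U

    module _ {v₂} (v₂∈U : v₂ ∈ U s) (v₂∉L : v₂ ∉ L s) (δ<k : δ s v₂ < k s v₂) where

      v₁≢v₂ : ¬ v₁ ≡ v₂
      v₁≢v₂ refl = true≢false (trans (sym (∈⇒lookup v₂∈U)) (trans (U≡V-v₁ v₁) (cong not (==-refl v₁))))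

      -- Next to the removed v₁ the threshold of v₂ is down to 1, so δ s v₂ = 0.
      v₂-isolated : adj G v₁ v₂ ≡ true → ∀ i → U∖L s i ≡ true → adj G i v₂ ≡ false
      v₂-isolated v₁~v₂ i i∈ with adj G i v₂ in i~v₂
      ... | false = refl
      ... | true = ⊥-elim (<⇒≱ (begin-strict
          degIn v₂ (U∖L s)
        ≡⟨ sym (δ≡degIn-U∖L I v₂ (∈⇒lookup v₂∈U)) ⟩
          δ s v₂
        <⟨ δ<k ⟩
          k s v₂
        ≡⟨ k≡k₁ v₂ (∈⇒lookup v₂∈U) ⟩
          k₁ σ v₂
        ≤⟨ k₁≤1 σ v₂ v₁~v₂ ⟩
          1
        ∎) (degIn≥1 v₂ i~v₂ i∈))
        where open ≤-Reasoning

      v₂-choice : AfterFirstSeed σ s → δ₁ σ v₂ < k₁ σ v₂ ⊎ ∃ λ z → Case3Choice σ z × ¬ z ≡ v₂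
      v₂-choice (no-case3-yet U∖L≗) =
        inj₁ (subst₂ _<_ (δ≡δ₁ U∖L≗ v₂ (∈⇒lookup v₂∈U)) (k≡k₁ v₂ (∈⇒lookup v₂∈U)) δ<k)
      v₂-choice (first-case3 z z∈L choice) = inj₂ (z , choice , λ { refl → v₂∉L (lookup⇒∈ z∈L) })

    transition : ∀ {s'} → Step G s s' → AfterFirstSeed σ s → Phase s'
    transition (case1 v v∈U kv≡0) _ = ⊥-elim (<⇒≱ (k≥1 v (∈⇒lookup v∈U)) (≤-reflexive kv≡0))
    transition st@(case3 _ _ _ _ _ _) (first-case3 z z∈L choice) =
      one-seed σ S≡v₁ U≡V-v₁ (λ i i∈ → U∖L⊆W₁ i (U∖L-shrinks st i i∈)) (first-case3 z (L-grows st z z∈L) choice)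
    transition st@(case3 _ no-case2 x x∈U x∉L ratio-max) (no-case3-yet U∖L≗) =
      one-seed σ S≡v₁ U≡V-v₁ (λ i i∈ → U∖L⊆W₁ i (U∖L-shrinks st i i∈))
        (first-case3 x (lookup-∪⁅⁆ (L s) x) (case3-choice U∖L≗ no-case2 x∈U x∉L ratio-max))
    transition st@(case2 _ v₂ v₂∈U v₂∉L δ<k) history = two-seeds record
      { σ = σ
      ; v₂ = v₂
      ; S≡v₁,v₂ = λ i → trans (lookup-∪ (S s) ⁅ v₂ ⁆ i) (cong₂ _∨_ (S≡v₁ i) (lookup-⁅⁆ v₂ i))
      ; v₁≢v₂ = v₁≢v₂ v₂∈U v₂∉L δ<k
      ; v₁∉U = trans (lookup-- (U s) v₂ v₁) (cong (_∧ not (v₂ == v₁)) (trans (U≡V-v₁ v₁) (cong not (==-refl v₁))))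
      ; v₂∉U = trans (lookup-- (U s) v₂ v₂) (trans (cong (λ b → inU s v₂ ∧ not b) (==-refl v₂)) (∧-zeroʳ _))
      ; v₂∈W₁ = U∖L⊆W₁ v₂ (∈U∖L s v₂∈U v₂∉L)
      ; U∖L⊆W₁ = λ i i∈ → U∖L⊆W₁ i (U∖L-shrinks st i i∈)
      ; v₂-isolated = λ v₁~v₂ i i∈ → v₂-isolated v₂∈U v₂∉L δ<k v₁~v₂ i (U∖L-shrinks st i i∈)
      ; v₂-choice = v₂-choice v₂∈U v₂∉L δ<k history
      }

  -- At a third Case 2 the removed nodes form a thin cut, which forces v₁ and v₂ to be adjacent
  -- leaves of W₁; then either Φ W₁ ≥ 4K or the Case-3 choice made right after v₁ was seeded
  -- would have preferred v₂.
  module ThirdSeed (dirac : Dirac G) {s : State n} (I : Invariant (λ _ → 2) s) (ts : TwoSeeds s)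
    (k≢0 : ∀ u → inU s u ≡ true → ¬ k s u ≡ 0) {v₃ : Fin n} (v₃∈U∖L : U∖L s v₃ ≡ true) where
    open TwoSeeds ts
    open FirstSeed σ

    v₃∈U : inU s v₃ ≡ true
    v₃∈U = ∧-conicalˡ (inU s v₃) _ v₃∈U∖L

    v₃∈W₁ : W₁ v₃ ≡ true
    v₃∈W₁ = U∖L⊆W₁ v₃ v₃∈U∖L

    v₃≢v₁ : ¬ v₃ ≡ v₁
    v₃≢v₁ refl = true≢false (trans (sym v₃∈U) v₁∉U)

    v₃≢v₂ : ¬ v₃ ≡ v₂
    v₃≢v₂ refl = true≢false (trans (sym v₃∈U) v₂∉U)

    thin : ∀ u → Uᶜ s u ≡ false → degIn u (Uᶜ s) ≤ 1
    thin u u∈U = 2∸c≢0⇒c≤1 _ (λ 2∸c≡0 → k≢0 u u∈U' (trans (k≡t∸degIn-Uᶜ I u u∈U') 2∸c≡0))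
      where
      u∈U' : inU s u ≡ true
      u∈U' = trans (sym (not-involutive (inU s u))) (cong not u∈U)

    open ThinCut dirac (Uᶜ s) thin v₁≢v₂ (cong not v₁∉U) (cong not v₂∉U) (cong not v₃∈U)

    v₁~v₂ : adj G v₁ v₂ ≡ true
    v₁~v₂ = D-clique v₂ v₁ (cong not v₂∉U) (cong not v₁∉U) (λ v₂≡v₁ → v₁≢v₂ (sym v₂≡v₁))

    v₁-leaf : ∀ w → W₁ w ≡ true → adj G w v₁ ≡ true → w ≡ v₂
    v₁-leaf w w∈W₁ w~v₁ with w ≟ v₂
    ... | yes w≡v₂ = w≡v₂
    ... | no w≢v₂ = ⊥-elim (<⇒≱ (s≤s deg-v₁≤1)
      (degIn≥2 v₁ w≢v₂ w~v₁ w∈W₁ (trans (adj-sym G v₂ v₁) v₁~v₂) v₂∈W₁))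

    v₁≁ : ∀ y → W₁ y ≡ true → ¬ y ≡ v₂ → adj G v₁ y ≡ false
    v₁≁ y y∈W₁ y≢v₂ with adj G v₁ y in v₁~y
    ... | false = refl
    ... | true = ⊥-elim (y≢v₂ (v₁-leaf y y∈W₁ (trans (adj-sym G y v₁) v₁~y)))

    3≤m : 3 ≤ m
    3≤m with count≥1⇒∃ (λ w → adj G w v₃ ∧ Uᶜ s w) (Dᶜ-covered v₃ (cong not v₃∈U))
    ... | d₃ , d₃∈ = ≤-trans (+-monoʳ-≤ 2 (count≥1 ((Uᶜ s ∖ v₁) ∖ v₂) d₃∈rest))
      (count-<-pick₂ {p = Uᶜ s} {q = (Uᶜ s ∖ v₁) ∖ v₂} v₁ v₂ rest⊆D (cong not v₁∉U) (cong not v₂∉U) v₁≢v₂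
        (cong (_∧ not (v₂ == v₁)) (∉∖ (Uᶜ s) v₁)) (∉∖ (Uᶜ s ∖ v₁) v₂))
      where
      rest⊆D : ∀ w → ((Uᶜ s ∖ v₁) ∖ v₂) w ≡ true → Uᶜ s w ≡ true
      rest⊆D w w∈ = ∖⇒∈ {X = Uᶜ s} (∖⇒∈ {X = Uᶜ s ∖ v₁} w∈)
      d₃~v₃ = ∧-conicalˡ (adj G d₃ v₃) _ d₃∈
      d₃≢ : ∀ v → adj G v₃ v ≡ false → ¬ d₃ ≡ v
      d₃≢ v v₃≁v refl = true≢false (trans (sym d₃~v₃) (trans (adj-sym G v v₃) v₃≁v))
      d₃∈rest : ((Uᶜ s ∖ v₁) ∖ v₂) d₃ ≡ true
      d₃∈rest = ∈∖ {X = Uᶜ s ∖ v₁} (∈∖ {X = Uᶜ s} (∧-conicalʳ _ _ d₃∈)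
          (d₃≢ v₁ (trans (adj-sym G v₃ v₁) (v₁≁ v₃ v₃∈W₁ v₃≢v₂))))
        (d₃≢ v₂ (v₂-isolated v₁~v₂ v₃ v₃∈U∖L))

    δ₁-v₂≤1 : δ₁ σ v₂ ≤ 1
    δ₁-v₂≤1 = ≤-trans (count-mono nbr-in-U) (D-outdegree≤1 3≤m v₂ (cong not v₂∉U))
      where
      nbr-in-U : ∀ w → (adj G w v₂ ∧ (W₁ ∖ v₁) w) ≡ true → (adj G w v₂ ∧ Dᶜ w) ≡ true
      nbr-in-U w w∈ with inU s w in w∈U
      ... | true = cong (_∧ true) (∧-conicalˡ (adj G w v₂) _ w∈)
      ... | false = ⊥-elim (true≢false (trans (sym (∧-conicalˡ (adj G w v₂) _ w∈))
          (subst (λ x → adj G x v₂ ≡ false) (sym (v₁-leaf w w∈W₁ w~v₁)) (loopless G v₂))))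
        where
        w∈W₁∖v₁ = ∧-conicalʳ (adj G w v₂) _ w∈
        w∈W₁ = ∖⇒∈ {X = W₁} w∈W₁∖v₁
        w~v₁ = D-clique v₁ w (cong not v₁∉U) (cong not w∈U) (λ v₁≡w → ∖⇒≢ {X = W₁} w∈W₁∖v₁ (sym v₁≡w))

    δ₁-v₂≢0 : ¬ δ₁ σ v₂ ≡ 0
    δ₁-v₂≢0 δ₁≡0 =
      <⇒≱ Φ<4K (TwoLeaves.4K≤Φ W₁ v₁≢v₂ v₃≢v₁ v₃≢v₂ v₁∈W₁ v₂∈W₁ v₃∈W₁ deg-v₁≤1 deg-v₂≤1 isolated)
      where
      deg-v₂≤1 : degIn v₂ W₁ ≤ 1
      deg-v₂≤1 = ≤-trans (≤-reflexive (degIn-∖ v₂ W₁ v₁))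
        (≤-trans (+-mono-≤ (bit≤1 _) (≤-reflexive δ₁≡0)) (≤-reflexive (+-identityʳ 1)))
      isolated : ∀ y → W₁ y ≡ true → ¬ y ≡ v₁ → ¬ y ≡ v₂ → (adj G v₁ y ≡ false) × (adj G v₂ y ≡ false)
      isolated y y∈W₁ y≢v₁ y≢v₂ = v₁≁ y y∈W₁ y≢v₂ , v₂≁y
        where
        v₂≁y : adj G v₂ y ≡ false
        v₂≁y with adj G v₂ y in v₂~y
        ... | false = refl
        ... | true = ⊥-elim (n≮0 (≤-trans
          (degIn≥1 v₂ (trans (adj-sym G y v₂) v₂~y) (∈∖ {X = W₁} y∈W₁ y≢v₁)) (≤-reflexive δ₁≡0)))

    δ₁-v₂≢1 : ¬ δ₁ σ v₂ ≡ 1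
    δ₁-v₂≢1 δ₁≡1 with v₂-choice
    ... | inj₁ δ₁<k₁ = <⇒≱ (subst (_< k₁ σ v₂) δ₁≡1 δ₁<k₁) (k₁≤1 σ v₂ v₁~v₂)
    ... | inj₂ (z , (z∈W₁∖v₁ , z-no-case2 , z-ratio-max) , z≢v₂) = 6≰4 (begin
        6
      ≤⟨ *-mono-≤ (k₁≥1 σ v₂) (*-mono-≤ 2≤δ₁z (s≤s 2≤δ₁z)) ⟩
        k₁ σ v₂ * (δ₁ σ z * suc (δ₁ σ z))
      ≤⟨ z-ratio-max v₂ (∈∖ {X = W₁} v₂∈W₁ (λ v₂≡v₁ → v₁≢v₂ (sym v₂≡v₁))) ⟩
        k₁ σ z * (δ₁ σ v₂ * suc (δ₁ σ v₂))
      ≡⟨ cong₂ (λ a b → a * (b * suc b)) k₁z≡2 δ₁≡1 ⟩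
        4
      ∎)
      where
      open ≤-Reasoning
      6≰4 : ¬ 6 ≤ 4
      6≰4 (s≤s (s≤s (s≤s (s≤s ()))))
      z∈W₁ = ∖⇒∈ {X = W₁} z∈W₁∖v₁
      k₁z≡2 : k₁ σ z ≡ 2
      k₁z≡2 = cong (2 ∸_) (count-none (λ w → v₁-only w))
        where
        v₁-only : ∀ w → (adj G w z ∧ (v₁ == w)) ≡ false
        v₁-only w with v₁ == w in v₁=w
        ... | false = ∧-zeroʳ (adj G w z)
        ... | true rewrite sym (==⇒≡ v₁=w) | v₁≁ z z∈W₁ z≢v₂ = refl
      2≤δ₁z : 2 ≤ δ₁ σ z
      2≤δ₁z = subst (_≤ δ₁ σ z) k₁z≡2 (≮⇒≥ z-no-case2)

    impossible : Empty
    impossible with δ₁ σ v₂ in δ₁≡ | δ₁-v₂≤1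
    ... | zero | _ = δ₁-v₂≢0 δ₁≡
    ... | suc zero | _ = δ₁-v₂≢1 δ₁≡
    ... | suc (suc _) | s≤s ()

  TwoSeeds-preserved : ∀ {s s'} → Step G s s' → (∀ i → inS s' i ≡ inS s i) → TwoSeeds s → TwoSeeds s'
  TwoSeeds-preserved st S'≡S ts = record
    { σ = σ
    ; v₂ = v₂
    ; S≡v₁,v₂ = λ i → trans (S'≡S i) (S≡v₁,v₂ i)
    ; v₁≢v₂ = v₁≢v₂
    ; v₁∉U = Uᶜ-grows st _ v₁∉U
    ; v₂∉U = Uᶜ-grows st _ v₂∉U
    ; v₂∈W₁ = v₂∈W₁
    ; U∖L⊆W₁ = λ i i∈ → U∖L⊆W₁ i (U∖L-shrinks st i i∈)
    ; v₂-isolated = λ v₁~v₂ i i∈ → v₂-isolated v₁~v₂ i (U∖L-shrinks st i i∈)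
    ; v₂-choice = v₂-choice
    }
    where open TwoSeeds ts

  phase-step : Dirac G → ∀ {s s'} → Invariant (λ _ → 2) s → Step G s s' → Phase s → Phase s'
  phase-step _ I st (no-seed S≡∅ U≡V Φ<4K) = NoSeed.transition I S≡∅ U≡V Φ<4K st
  phase-step _ I st (one-seed σ S≡v₁ U≡V-v₁ U∖L⊆W₁ history) =
    OneSeed.transition σ I S≡v₁ U≡V-v₁ U∖L⊆W₁ st history
  phase-step _ I st@(case1 _ _ _) (two-seeds ts) = two-seeds (TwoSeeds-preserved st (λ _ → refl) ts)
  phase-step _ I st@(case3 _ _ _ _ _ _) (two-seeds ts) = two-seeds (TwoSeeds-preserved st (λ _ → refl) ts)
  phase-step dirac {s} I (case2 no-case1 v₃ v₃∈U v₃∉L _) (two-seeds ts) =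
    ⊥-elim (ThirdSeed.impossible dirac I ts (λ u u∈U → no-case1 u (lookup⇒∈ u∈U)) (∈U∖L s v₃∈U v₃∉L))

  phase-init : Dirac G → Phase (initState G (λ _ → 2))
  phase-init dirac = no-seed lookup-⊥ lookup-⊤
    (≤-trans (s≤s (≤-reflexive (Φ-cong (λ w → cong₂ (λ a b → a ∧ not b) (lookup-⊤ w) (lookup-⊥ w)))))
      (Φ-Dirac<4K dirac))

  run-∣S∣≤2 : Dirac G → ∀ {s R} → RunFrom G s R → Invariant (λ _ → 2) s → Phase s → ∣ R ∣ ≤ 2
  run-∣S∣≤2 dirac {s} (done _) I P = ≤-trans (≤-reflexive (∣p∣≡count (S s))) (∣S∣≤2 P)
  run-∣S∣≤2 dirac (step st run) I P = run-∣S∣≤2 dirac run (invariant-step st I) (phase-step dirac I st P)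

  MTS-∣R∣≤2 : Dirac G → ∀ R → MTSReturns G (λ _ → 2) R → ∣ R ∣ ≤ 2
  MTS-∣R∣≤2 dirac R run = run-∣S∣≤2 dirac run (invariant-init (λ _ → 2)) (phase-init dirac)

corollary1 : (n : ℕ) (G : Graph n) → Dirac G →
    (R : Subset n) → MTSReturns G (λ _ → 2) R →
    IsTargetSet G (λ _ → 2) R ×
    ((S' : Subset n) → IsTargetSet G (λ _ → 2) S' → ∣ R ∣ ≤ ∣ S' ∣)
corollary1 n G dirac R run = MTS-isTargetSet G (λ _ → 2) R run , minimum
  where
  minimum : (S' : Subset n) → IsTargetSet G (λ _ → 2) S' → ∣ R ∣ ≤ ∣ S' ∣
  minimum S' target = ≤-trans (⊓-glb (MTS-∣R∣≤2 G dirac R run) (∣p∣≤n R)) (2⊓n≤∣targetSet∣ G S' target)
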